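{- For all nonnegative integers $p,q,\rho$, the Hamming ball $B_\rho[p,q]$, partially ordered by strict inclusion $\subsetneq$, is a LYM poset.
   Context: Let $p,q,\rho$ be nonnegative integers. The Hamming ball $B_\rho[p,q]$ is the family of all subsets $S\subseteq\{1,\dots,p+q\}$ whose symmetric difference with $\{1,\dots,p\}$ has at most $\rho$ elements (i.e. $S$ is at graph distance at most $\rho$ from $\{1,\dots,p\}$ in the hypercube graph on $2^{[p+q]}$, whose edges join sets differing in exactly one element). It is ordered by strict inclusion. For a finite poset $(P,<)$, the rank $r:P\to\{0,1,2,\dots\}$ is defined recursively by $r(x')=0$ if no $x\in P$ satisfies $x<x'$, and $r(x')=\max\{r(x): x<x'\}+1$ otherwise. The layer $P_k$ is the set of elements of rank $k$. An antichain is a subset $A\subseteq P$ in which any two distinct elements are incomparable. $P$ is called a LYM poset if every antichain $A\subseteq P$ satisfies $\sum_{x\in A}\frac{1}{|P_{r(x)}|}\le 1$. -}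

module Defs where

open import Data.Nat using (ℕ; zero; suc; _+_; _≤_; _≤?_; _⊔_; _≟_)
open import Data.Vec using (Vec; []; _∷_; replicate; _++_)
open import Data.List using (List; []; _∷_; map; concatMap; filter; length; foldr)
open import Data.List.Membership.Propositional using (_∈_)
open import Data.List.Relation.Unary.Unique.Propositional using (Unique)
open import Data.List.Relation.Unary.All using (All)
open import Data.Fin.Subset using (Subset; inside; outside; _─_; _∪_; ∣_∣; _⊂_)
open import Data.Fin.Subset.Properties using (_⊂?_)
open import Data.Integer using (+_)
open import Data.Rational using (ℚ; _/_; 0ℚ; 1ℚ) renaming (_+_ to _+ℚ_; _≤_ to _≤ℚ_)
open import Relation.Nullary using (¬_)

allSubsets : (n : ℕ) → List (Subset n)
allSubsets zero    = [] ∷ []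
allSubsets (suc n) = concatMap (λ s → (outside ∷ s) ∷ (inside ∷ s) ∷ []) (allSubsets n)

-- The centre {1,…,p} ⊆ {1,…,p+q} (0-indexed: the first p coordinates).
centre : (p q : ℕ) → Subset (p + q)
centre p q = replicate p inside ++ replicate q outside

hammingDist : {n : ℕ} → Subset n → Subset n → ℕ
hammingDist S T = ∣ (S ─ T) ∪ (T ─ S) ∣

hammingBall : (p q ρ : ℕ) → List (Subset (p + q))
hammingBall p q ρ = filter (λ S → hammingDist S (centre p q) ≤? ρ) (allSubsets (p + q))

maxList : List ℕ → ℕ
maxList = foldr _⊔_ 0

rankFuel : {n : ℕ} → ℕ → List (Subset n) → Subset n → ℕ
rankFuel zero    P x = 0
rankFuel (suc k) P x = maxList (map (λ y → suc (rankFuel k P y)) (filter (λ y → y ⊂? x) P))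

-- Rank in the poset (P, ⊂). Every chain has at most |P| elements, so
-- |P| unfoldings of the recursion compute the rank exactly.
rank : {n : ℕ} → List (Subset n) → Subset n → ℕ
rank P x = rankFuel (length P) P x

layerSize : {n : ℕ} → List (Subset n) → ℕ → ℕ
layerSize P k = length (filter (λ y → rank P y ≟ k) P)

-- 1/m (only applied to m ≥ 1: a layer containing x is nonempty)
inv : ℕ → ℚ
inv zero    = 0ℚ
inv (suc m) = + 1 / suc m

sumℚ : List ℚ → ℚ
sumℚ = foldr _+ℚ_ 0ℚ

IsAntichain : {n : ℕ} → List (Subset n) → List (Subset n) → Set
IsAntichain P A =
  Unique A × All (λ x → x ∈ P) A × (∀ {x y} → x ∈ A → y ∈ A → ¬ (x ⊂ y))
  where open import Data.Product using (_×_)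

IsLYM : {n : ℕ} → List (Subset n) → Set
IsLYM P = (A : List (Subset _)) → IsAntichain P A →
  sumℚ (map (λ x → inv (layerSize P (rank P x))) A) ≤ℚ 1ℚ

{-# OPTIONS --safe #-}
module Submission where

open import Defs
open import Algebra.Bundles using (CommutativeSemiring)
open import Data.Nat using (ℕ; suc; _<_)
open import Data.List using (List)
open import Data.List.Membership.Propositional using (_∈_)
open import Data.Fin.Subset using (Subset; _⊂_)
open import Data.Product using (_×_; ∃)
open import Relation.Binary.PropositionalEquality using (_≡_)

-- A finite poset is LYM as soon as it carries a nonnegative flow along < in which
-- every element x receives its layer weight μ x = 1/|P_r(x)|, minimal elements
-- excepted, and passes on at most μ x: cutting P along the up-set of an antichain A,
-- all flow into A crosses the cut, so the μ-weight of A is at most the total weight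
-- of the minimal elements, which is 1.
--
-- In B_ρ[p,q] the elements of size k are classified, up to the symmetries fixing the
-- centre, by the number u of their points in the centre; there are C(p,u) C(q,k-u)
-- of each admissible type.  The flow couples the type distributions of consecutive
-- levels monotonically, type u moving to type u or u + 1 only.  This is possible
-- because these counts are totally positive of order 2 (binomial coefficients are
-- log-concave), which makes the cumulative type distributions of consecutive levels
-- interlace.  The mass of each move is spread evenly over the covering pairs
-- realising it.

module FiniteSums {a ℓ} (S : CommutativeSemiring a ℓ) where
  open import Data.Nat as ℕ using (ℕ; zero; suc)
  import Data.Nat.Properties as ℕ
  open import Data.Bool using (true; false; if_then_else_)
  open import Data.List using (List; []; _∷_; _++_; filter; concatMap)
  open import Data.List.Membership.Propositional using (_∈_)
  open import Data.List.Relation.Unary.Any using (here; there)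
  open import Relation.Nullary using (does)
  open import Function using (_∘_)
  open import Relation.Unary using (Pred; Decidable)
  import Relation.Binary.PropositionalEquality as ≡
  open CommutativeSemiring S renaming (Carrier to R)
  open import Relation.Binary.Reasoning.Setoid setoid
  open import Algebra.Properties.CommutativeSemigroup +-commutativeSemigroup using (interchange)

  ∑ : ∀ {b} {A : Set b} → List A → (A → R) → R
  ∑ []       f = 0#
  ∑ (x ∷ xs) f = f x + ∑ xs f

  syntax ∑ xs (λ x → e) = ∑[ x ← xs ] e

  module _ {b} {A : Set b} where

    ∑-cong : ∀ xs {f g : A → R} → (∀ {x} → x ∈ xs → f x ≈ g x) → ∑ xs f ≈ ∑ xs g
    ∑-cong []       f≈g = refl
    ∑-cong (x ∷ xs) f≈g = +-cong (f≈g (here ≡.refl)) (∑-cong xs (f≈g ∘ there))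

    ∑-0 : ∀ (xs : List A) → ∑[ x ← xs ] 0# ≈ 0#
    ∑-0 []       = refl
    ∑-0 (x ∷ xs) = trans (+-identityˡ _) (∑-0 xs)

    ∑-+ : ∀ xs (f g : A → R) → ∑[ x ← xs ] (f x + g x) ≈ ∑ xs f + ∑ xs g
    ∑-+ []       f g = sym (+-identityˡ 0#)
    ∑-+ (x ∷ xs) f g = trans (+-congˡ (∑-+ xs f g)) (interchange (f x) (g x) _ _)

    ∑-*ˡ : ∀ xs (c : R) (f : A → R) → ∑[ x ← xs ] (c * f x) ≈ c * ∑ xs f
    ∑-*ˡ []       c f = sym (zeroʳ c)
    ∑-*ˡ (x ∷ xs) c f = trans (+-congˡ (∑-*ˡ xs c f)) (sym (distribˡ c (f x) _))

    ∑-++ : ∀ xs ys (f : A → R) → ∑ (xs ++ ys) f ≈ ∑ xs f + ∑ ys f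
    ∑-++ []       ys f = sym (+-identityˡ _)
    ∑-++ (x ∷ xs) ys f = trans (+-congˡ (∑-++ xs ys f)) (sym (+-assoc _ _ _))

    ∑-filter : ∀ {p} {P : Pred A p} (P? : Decidable P) xs (f : A → R) →
               ∑ (filter P? xs) f ≈ ∑[ x ← xs ] (if does (P? x) then f x else 0#)
    ∑-filter P? []       f = refl
    ∑-filter P? (x ∷ xs) f with does (P? x)
    ... | true  = +-congˡ (∑-filter P? xs f)
    ... | false = trans (∑-filter P? xs f) (sym (+-identityˡ _))

  module _ {b c} {A : Set b} {B : Set c} where

    ∑-swap : ∀ xs ys (f : A → B → R) →
             ∑[ x ← xs ] ∑[ y ← ys ] f x y ≈ ∑[ y ← ys ] ∑[ x ← xs ] f x y
    ∑-swap []       ys f = sym (∑-0 ys)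
    ∑-swap (x ∷ xs) ys f = trans (+-congˡ (∑-swap xs ys f)) (sym (∑-+ ys (f x) _))

    ∑-concatMap : ∀ (g : A → List B) xs (f : B → R) →
                  ∑ (concatMap g xs) f ≈ ∑[ x ← xs ] ∑ (g x) f
    ∑-concatMap g []       f = refl
    ∑-concatMap g (x ∷ xs) f = trans (∑-++ (g x) (concatMap g xs) f) (+-congˡ (∑-concatMap g xs f))

  ∑< : ℕ → (ℕ → R) → R
  ∑< zero    f = 0#
  ∑< (suc t) f = ∑< t f + f t

  syntax ∑< t (λ u → e) = ∑[ u < t ] e

  ∑<-cong : ∀ t {f g : ℕ → R} → (∀ u → u ℕ.< t → f u ≈ g u) → ∑< t f ≈ ∑< t g
  ∑<-cong zero    f≈g = refl
  ∑<-cong (suc t) f≈g = +-cong (∑<-cong t (λ u u<t → f≈g u (ℕ.m<n⇒m<1+n u<t))) (f≈g t (ℕ.n<1+n t))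

  ∑<-0 : ∀ t → ∑[ u < t ] 0# ≈ 0#
  ∑<-0 zero    = refl
  ∑<-0 (suc t) = trans (+-identityʳ _) (∑<-0 t)

  ∑<-*ˡ : ∀ t (c : R) (f : ℕ → R) → ∑[ u < t ] (c * f u) ≈ c * ∑< t f
  ∑<-*ˡ zero    c f = sym (zeroʳ c)
  ∑<-*ˡ (suc t) c f = trans (+-congʳ (∑<-*ˡ t c f)) (sym (distribˡ c _ (f t)))

  ∑<-suc : ∀ t (f : ℕ → R) → ∑< (suc t) f ≈ f 0 + ∑[ u < t ] f (suc u)
  ∑<-suc zero    f = trans (+-identityˡ _) (sym (+-identityʳ _))
  ∑<-suc (suc t) f = trans (+-congʳ (∑<-suc t f)) (+-assoc _ _ _)

  ∑<-+ : ∀ t d (f : ℕ → R) → ∑< (t ℕ.+ d) f ≈ ∑< t f + ∑[ i < d ] f (t ℕ.+ i)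
  ∑<-+ t zero    f = trans (reflexive (≡.cong (λ m → ∑< m f) (ℕ.+-identityʳ t))) (sym (+-identityʳ _))
  ∑<-+ t (suc d) f = begin
    ∑< (t ℕ.+ suc d) f                               ≡⟨ ≡.cong (λ m → ∑< m f) (ℕ.+-suc t d) ⟩
    ∑< (t ℕ.+ d) f + f (t ℕ.+ d)                     ≈⟨ +-congʳ (∑<-+ t d f) ⟩
    ∑< t f + ∑[ i < d ] f (t ℕ.+ i) + f (t ℕ.+ d)    ≈⟨ +-assoc _ _ _ ⟩
    ∑< t f + ∑[ i < suc d ] f (t ℕ.+ i)              ∎

  module _ {b} {A : Set b} where

    ∑<-∑-swap : ∀ t xs (f : ℕ → A → R) →
                ∑[ u < t ] ∑[ x ← xs ] f u x ≈ ∑[ x ← xs ] ∑[ u < t ] f u x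
    ∑<-∑-swap zero    xs f = sym (∑-0 xs)
    ∑<-∑-swap (suc t) xs f = trans (+-congʳ (∑<-∑-swap t xs f)) (sym (∑-+ xs _ (f t)))

module Binomial where
  open import Data.Nat
  open import Data.Nat.Properties
  open import Data.Nat.Combinatorics using (_C_; k>n⇒nCk≡0; nC1≡n; nCk+nC[k+1]≡[n+1]C[k+1])
  open import Data.Nat.Solver using (module +-*-Solver)
  open import Relation.Binary.PropositionalEquality
  open import Relation.Nullary using (yes; no)
  open +-*-Solver

  0<nCk : ∀ {n k} → k ≤ n → 0 < n C k
  0<nCk {n}     {zero}  _         = s≤s z≤n
  0<nCk {suc n} {suc k} (s≤s k≤n) = begin-strict
    0                    <⟨ 0<nCk k≤n ⟩
    n C k                ≤⟨ m≤m+n (n C k) (n C suc k) ⟩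
    n C k + n C suc k    ≡⟨ nCk+nC[k+1]≡[n+1]C[k+1] n k ⟩
    suc n C suc k        ∎
    where open ≤-Reasoning

  [k+1]*nC[k+1]≡[n-k]*nCk : ∀ n k → suc k * (n C suc k) ≡ (n ∸ k) * (n C k)
  [k+1]*nC[k+1]≡[n-k]*nCk zero k = begin
    suc k * (0 C suc k)    ≡⟨ *-zeroʳ (suc k) ⟩
    0                      ≡⟨ cong (_* (0 C k)) (0∸n≡0 k) ⟨
    (0 ∸ k) * (0 C k)      ∎
    where open ≡-Reasoning
  [k+1]*nC[k+1]≡[n-k]*nCk (suc n) zero = begin
    1 * (suc n C 1)        ≡⟨ *-identityˡ (suc n C 1) ⟩
    suc n C 1              ≡⟨ nC1≡n (suc n) ⟩
    suc n                  ≡⟨ *-identityʳ (suc n) ⟨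
    suc n * (suc n C 0)    ∎
    where open ≡-Reasoning
  [k+1]*nC[k+1]≡[n-k]*nCk (suc n) (suc k) = begin
    (2 + k) * (suc n C (2 + k))
      ≡⟨ cong ((2 + k) *_) (nCk+nC[k+1]≡[n+1]C[k+1] n (suc k)) ⟨
    (2 + k) * (a + b)
      ≡⟨ solve 3 (λ k a b → (con 2 :+ k) :* (a :+ b) := (con 1 :+ k) :* a :+ (a :+ (con 2 :+ k) :* b)) refl k a b ⟩
    suc k * a + (a + (2 + k) * b)
      ≡⟨ cong₂ (λ x y → x + (a + y)) ([k+1]*nC[k+1]≡[n-k]*nCk n k) ([k+1]*nC[k+1]≡[n-k]*nCk n (suc k)) ⟩
    (n ∸ k) * (n C k) + (a + (n ∸ suc k) * a)
      ≡⟨ cong ((n ∸ k) * (n C k) +_) a+[n∸[1+k]]*a≡[n∸k]*a ⟩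
    (n ∸ k) * (n C k) + (n ∸ k) * a
      ≡⟨ *-distribˡ-+ (n ∸ k) (n C k) a ⟨
    (n ∸ k) * (n C k + a)
      ≡⟨ cong ((n ∸ k) *_) (nCk+nC[k+1]≡[n+1]C[k+1] n k) ⟩
    (n ∸ k) * (suc n C suc k) ∎
    where
    open ≡-Reasoning
    a = n C suc k
    b = n C (2 + k)
    a+[n∸[1+k]]*a≡[n∸k]*a : a + (n ∸ suc k) * a ≡ (n ∸ k) * a
    a+[n∸[1+k]]*a≡[n∸k]*a with k <? n
    ... | yes k<n = cong (_* a) (trans (cong suc (sym (pred[m∸n]≡m∸[1+n] n k)))
                                       (suc-pred (n ∸ k) {{>-nonZero (m<n⇒0<n∸m k<n)}}))
    ... | no  k≮n rewrite k>n⇒nCk≡0 (s≤s (≮⇒≥ k≮n)) = trans (*-zeroʳ (n ∸ suc k)) (sym (*-zeroʳ (n ∸ k)))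

  nCa*nC[1+b]≤nC[1+a]*nCb : ∀ n {a b} → a ≤ b → (n C a) * (n C suc b) ≤ (n C suc a) * (n C b)
  nCa*nC[1+b]≤nC[1+a]*nCb n {a} {b} a≤b = *-cancelʳ-≤ _ _ (suc a * suc b) (begin
    x * y′ * (suc a * suc b)    ≡⟨ solve 4 (λ x y′ a′ b′ → x :* y′ :* (a′ :* b′) := x :* a′ :* (b′ :* y′)) refl x y′ (suc a) (suc b) ⟩
    x * suc a * (suc b * y′)    ≡⟨ cong (x * suc a *_) ([k+1]*nC[k+1]≡[n-k]*nCk n b) ⟩
    x * suc a * ((n ∸ b) * y)   ≤⟨ *-monoʳ-≤ (x * suc a) (*-monoˡ-≤ y (∸-monoʳ-≤ n a≤b)) ⟩
    x * suc a * ((n ∸ a) * y)   ≡⟨ solve 4 (λ x a′ d y → x :* a′ :* (d :* y) := d :* x :* (y :* a′)) refl x (suc a) (n ∸ a) y ⟩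
    (n ∸ a) * x * (y * suc a)   ≡⟨ cong (_* (y * suc a)) ([k+1]*nC[k+1]≡[n-k]*nCk n a) ⟨
    suc a * x′ * (y * suc a)    ≤⟨ *-monoʳ-≤ (suc a * x′) (*-monoʳ-≤ y (s≤s a≤b)) ⟩
    suc a * x′ * (y * suc b)    ≡⟨ solve 4 (λ a′ x′ y b′ → a′ :* x′ :* (y :* b′) := x′ :* y :* (a′ :* b′)) refl (suc a) x′ y (suc b) ⟩
    x′ * y * (suc a * suc b)    ∎)
    where
    open ≤-Reasoning
    x  = n C a
    x′ = n C suc a
    y  = n C b
    y′ = n C suc b

module RationalArithmetic where
  open import Data.Nat as ℕ using (ℕ; zero; suc)
  import Data.Nat.Properties as ℕ
  open import Data.Integer as ℤ using (+_)
  import Data.Integer.Properties as ℤ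
  open import Data.Rational
  open import Data.Rational.Properties
  open import Data.Rational.Unnormalised as ℚᵘ using (mkℚᵘ; *≡*; *≤*)
  import Data.Rational.Unnormalised.Properties as ℚᵘ
  open import Data.Rational.Solver using (module +-*-Solver)
  open import Data.Bool using (Bool; true; false)
  open import Data.List using ([]; _∷_; filter; length)
  open import Data.List.Membership.Propositional using (_∈_)
  open import Data.List.Relation.Unary.Any using (here; there)
  open import Relation.Binary.PropositionalEquality
  open import Relation.Nullary using (does; yes; no)
  open import Relation.Unary using (Pred; Decidable)
  open import Function using (_∘_)
  open import Defs using (inv)

  open import Algebra.Bundles using (CommutativeRing)

  module ∑ℚ = FiniteSums (CommutativeRing.commutativeSemiring +-*-commutativeRing)
  open ∑ℚ using (∑)

  -- Opaque, so that unification never unfolds fromℕ n into a normalised fraction.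
  opaque
    fromℕ : ℕ → ℚ
    fromℕ n = + n / 1

    fromℕ-0 : fromℕ 0 ≡ 0ℚ
    fromℕ-0 = refl

    fromℕ-1 : fromℕ 1 ≡ 1ℚ
    fromℕ-1 = refl

    private
      fromℕ≃ : ∀ n → toℚᵘ (fromℕ n) ℚᵘ.≃ mkℚᵘ (+ n) 0
      fromℕ≃ n = toℚᵘ-fromℚᵘ (mkℚᵘ (+ n) 0)

  𝟙 : Bool → ℚ
  𝟙 true  = 1ℚ
  𝟙 false = 0ℚ

  𝟙-nonNeg : ∀ b → 0ℚ ≤ 𝟙 b
  𝟙-nonNeg true  = *≤* (ℤ.+≤+ ℕ.z≤n)
  𝟙-nonNeg false = ≤-refl

  fromℕ-+ : ∀ m n → fromℕ (m ℕ.+ n) ≡ fromℕ m + fromℕ n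
  fromℕ-+ m n = toℚᵘ-injective (ℚᵘ.≃-trans (fromℕ≃ (m ℕ.+ n)) (ℚᵘ.≃-sym
    (ℚᵘ.≃-trans (toℚᵘ-homo-+ (fromℕ m) (fromℕ n)) (ℚᵘ.≃-trans (ℚᵘ.+-cong (fromℕ≃ m) (fromℕ≃ n)) (*≡* eq)))))
    where
    eq : (+ m ℤ.* + 1 ℤ.+ + n ℤ.* + 1) ℤ.* + 1 ≡ + (m ℕ.+ n) ℤ.* + 1
    eq rewrite ℤ.*-identityʳ (+ m) | ℤ.*-identityʳ (+ n) = refl

  fromℕ-* : ∀ m n → fromℕ (m ℕ.* n) ≡ fromℕ m * fromℕ n
  fromℕ-* m n = toℚᵘ-injective (ℚᵘ.≃-trans (fromℕ≃ (m ℕ.* n)) (ℚᵘ.≃-sym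
    (ℚᵘ.≃-trans (toℚᵘ-homo-* (fromℕ m) (fromℕ n)) (ℚᵘ.≃-trans (ℚᵘ.*-cong (fromℕ≃ m) (fromℕ≃ n)) (*≡* eq)))))
    where
    eq : (+ m ℤ.* + n) ℤ.* + 1 ≡ + (m ℕ.* n) ℤ.* + 1
    eq = cong (ℤ._* + 1) (sym (ℤ.pos-* m n))

  fromℕ-mono-≤ : ∀ {m n} → m ℕ.≤ n → fromℕ m ≤ fromℕ n
  fromℕ-mono-≤ {m} {n} m≤n = toℚᵘ-cancel-≤ (ℚᵘ.≤-respʳ-≃ (ℚᵘ.≃-sym (fromℕ≃ n))
    (ℚᵘ.≤-respˡ-≃ (ℚᵘ.≃-sym (fromℕ≃ m)) (*≤* (ℤ.*-monoʳ-≤-nonNeg (+ 1) (ℤ.+≤+ m≤n)))))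

  private
    inv≃ : ∀ m → toℚᵘ (inv (suc m)) ℚᵘ.≃ mkℚᵘ (+ 1) m
    inv≃ m = toℚᵘ-fromℚᵘ (mkℚᵘ (+ 1) m)

  inv-nonNeg : ∀ n → 0ℚ ≤ inv n
  inv-nonNeg zero    = ≤-refl
  inv-nonNeg (suc m) = toℚᵘ-cancel-≤ (ℚᵘ.≤-respʳ-≃ (ℚᵘ.≃-sym (inv≃ m)) (*≤* (ℤ.+≤+ ℕ.z≤n)))

  fromℕ*inv≡1 : ∀ n → 0 ℕ.< n → fromℕ n * inv n ≡ 1ℚ
  fromℕ*inv≡1 (suc m) _ = toℚᵘ-injective (ℚᵘ.≃-trans (toℚᵘ-homo-* (fromℕ (suc m)) (inv (suc m)))
    (ℚᵘ.≃-trans (ℚᵘ.*-cong (fromℕ≃ (suc m)) (inv≃ m)) (*≡* eq)))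
    where
    eq : (+ suc m ℤ.* + 1) ℤ.* + 1 ≡ + 1 ℤ.* + (1 ℕ.* suc m)
    eq = trans (ℤ.*-identityʳ _) (trans (ℤ.*-identityʳ _)
           (sym (trans (ℤ.*-identityˡ _) (cong +_ (ℕ.*-identityˡ (suc m))))))

  inv*fromℕ≤1 : ∀ n → inv n * fromℕ n ≤ 1ℚ
  inv*fromℕ≤1 zero    = ≤-trans (≤-reflexive (*-zeroˡ (fromℕ 0))) (𝟙-nonNeg true)
  inv*fromℕ≤1 (suc n) = ≤-reflexive (trans (*-comm (inv (suc n)) _) (fromℕ*inv≡1 (suc n) (ℕ.s≤s ℕ.z≤n)))

  *-monoˡ-≤-0≤ : ∀ {x y z} → 0ℚ ≤ x → y ≤ z → x * y ≤ x * z
  *-monoˡ-≤-0≤ {x} 0≤x = *-monoˡ-≤-nonNeg x {{nonNegative 0≤x}}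

  *-monoʳ-≤-0≤ : ∀ {x y z} → 0ℚ ≤ x → y ≤ z → y * x ≤ z * x
  *-monoʳ-≤-0≤ {x} 0≤x = *-monoʳ-≤-nonNeg x {{nonNegative 0≤x}}

  *-nonNeg : ∀ {x y} → 0ℚ ≤ x → 0ℚ ≤ y → 0ℚ ≤ x * y
  *-nonNeg {x} 0≤x 0≤y = ≤-trans (≤-reflexive (sym (*-zeroʳ x))) (*-monoˡ-≤-0≤ 0≤x 0≤y)

  𝟙*-nonNeg : ∀ b {x} → 0ℚ ≤ x → 0ℚ ≤ 𝟙 b * x
  𝟙*-nonNeg b 0≤x = *-nonNeg (𝟙-nonNeg b) 0≤x

  p≤q⇒0≤q-p : ∀ {x y} → x ≤ y → 0ℚ ≤ y - x
  p≤q⇒0≤q-p {x} {y} x≤y = subst (_≤ y - x) (+-inverseʳ x) (+-monoˡ-≤ (- x) x≤y)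

  x+y≡0⇒x≡0 : ∀ {x y} → 0ℚ ≤ x → 0ℚ ≤ y → x + y ≡ 0ℚ → x ≡ 0ℚ
  x+y≡0⇒x≡0 {x} {y} 0≤x 0≤y x+y≡0 = ≤-antisym (subst (x ≤_) x+y≡0 (subst (_≤ x + y) (+-identityʳ x) (+-monoʳ-≤ x 0≤y))) 0≤x

  +-cancelˡ-≤ : ∀ x {y z} → x + y ≤ x + z → y ≤ z
  +-cancelˡ-≤ x {y} {z} x+y≤x+z = subst₂ _≤_ (lemma y) (lemma z) (+-monoʳ-≤ (- x) x+y≤x+z)
    where
    lemma : ∀ w → - x + (x + w) ≡ w
    lemma w = trans (sym (+-assoc (- x) x w)) (trans (cong (_+ w) (+-inverseˡ x)) (+-identityˡ w))

  private
    expand : ∀ x y z → 0 ℕ.< y → fromℕ x * inv z ≡ fromℕ (x ℕ.* y) * (inv y * inv z)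
    expand x y z 0<y = begin
      fromℕ x * inv z                         ≡⟨ *-identityʳ _ ⟨
      fromℕ x * inv z * 1ℚ                    ≡⟨ cong (fromℕ x * inv z *_) (fromℕ*inv≡1 y 0<y) ⟨
      fromℕ x * inv z * (fromℕ y * inv y)
        ≡⟨ solve 4 (λ x z y y′ → x :* z :* (y :* y′) := x :* y :* (y′ :* z)) refl (fromℕ x) (inv z) (fromℕ y) (inv y) ⟩
      fromℕ x * fromℕ y * (inv y * inv z)     ≡⟨ cong (_* (inv y * inv z)) (fromℕ-* x y) ⟨
      fromℕ (x ℕ.* y) * (inv y * inv z)       ∎
      where
      open ≡-Reasoning
      open +-*-Solver

  fromℕ*inv[*]≡inv : ∀ {a} b → 0 ℕ.< a → fromℕ a * inv (a ℕ.* b) ≡ inv b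
  fromℕ*inv[*]≡inv {a} zero    0<a rewrite ℕ.*-zeroʳ a = *-zeroʳ (fromℕ a)
  fromℕ*inv[*]≡inv {a@(suc _)} (suc b) _ = begin
    fromℕ a * inv m                       ≡⟨ expand a (suc b) m (ℕ.s≤s ℕ.z≤n) ⟩
    fromℕ m * (inv (suc b) * inv m)       ≡⟨ solve 3 (λ x y z → x :* (y :* z) := x :* z :* y) refl (fromℕ m) (inv (suc b)) (inv m) ⟩
    fromℕ m * inv m * inv (suc b)         ≡⟨ cong (_* inv (suc b)) (fromℕ*inv≡1 m (ℕ.s≤s ℕ.z≤n)) ⟩
    1ℚ * inv (suc b)                      ≡⟨ *-identityˡ _ ⟩
    inv (suc b)                           ∎
    where
    open ≡-Reasoning
    open +-*-Solver
    m = a ℕ.* suc b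

  fromℕ*[x*inv[*]]≡x*inv : ∀ {a} b x → 0 ℕ.< a → fromℕ a * (x * inv (a ℕ.* b)) ≡ x * inv b
  fromℕ*[x*inv[*]]≡x*inv {a} b x 0<a = begin
    fromℕ a * (x * inv (a ℕ.* b))   ≡⟨ solve 3 (λ a x i → a :* (x :* i) := x :* (a :* i)) refl (fromℕ a) x (inv (a ℕ.* b)) ⟩
    x * (fromℕ a * inv (a ℕ.* b))   ≡⟨ cong (x *_) (fromℕ*inv[*]≡inv b 0<a) ⟩
    x * inv b                       ∎
    where
    open ≡-Reasoning
    open +-*-Solver

  fromℕ*[x*inv[*]]≤x*inv : ∀ a b {x} → 0ℚ ≤ x → fromℕ a * (x * inv (a ℕ.* b)) ≤ x * inv b
  fromℕ*[x*inv[*]]≤x*inv zero      b {x} 0≤x =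
    ≤-trans (≤-reflexive (trans (cong (_* (x * inv 0)) fromℕ-0) (*-zeroˡ (x * inv 0)))) (*-nonNeg 0≤x (inv-nonNeg b))
  fromℕ*[x*inv[*]]≤x*inv a@(suc _) b {x} _   = ≤-reflexive (fromℕ*[x*inv[*]]≡x*inv {a} b x (ℕ.s≤s ℕ.z≤n))

  [fromℕ*x]*inv≡x : ∀ {n} x → 0 ℕ.< n → fromℕ n * x * inv n ≡ x
  [fromℕ*x]*inv≡x {n} x 0<n = begin
    fromℕ n * x * inv n             ≡⟨ solve 3 (λ m x i → m :* x :* i := x :* (m :* i)) refl (fromℕ n) x (inv n) ⟩
    x * (fromℕ n * inv n)           ≡⟨ cong (x *_) (fromℕ*inv≡1 n 0<n) ⟩
    x * 1ℚ                          ≡⟨ *-identityʳ x ⟩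
    x                               ∎
    where
    open ≡-Reasoning
    open +-*-Solver

  fromℕ*inv-mono : ∀ a {b} c {d} → 0 ℕ.< b → 0 ℕ.< d → a ℕ.* b ℕ.≤ c ℕ.* d →
                   fromℕ a * inv d ≤ fromℕ c * inv b
  fromℕ*inv-mono a {b} c {d} 0<b 0<d ab≤cd = begin
    fromℕ a * inv d                       ≡⟨ expand a b d 0<b ⟩
    fromℕ (a ℕ.* b) * (inv b * inv d)     ≤⟨ *-monoʳ-≤-0≤ (*-nonNeg (inv-nonNeg b) (inv-nonNeg d)) (fromℕ-mono-≤ ab≤cd) ⟩
    fromℕ (c ℕ.* d) * (inv b * inv d)     ≡⟨ cong (fromℕ (c ℕ.* d) *_) (*-comm (inv b) (inv d)) ⟩
    fromℕ (c ℕ.* d) * (inv d * inv b)     ≡⟨ expand c d b 0<d ⟨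
    fromℕ c * inv b                       ∎
    where open ≤-Reasoning

  module _ {a} {A : Set a} where

    ∑-mono-≤ : ∀ xs {f g : A → ℚ} → (∀ {x} → x ∈ xs → f x ≤ g x) → ∑ xs f ≤ ∑ xs g
    ∑-mono-≤ []       f≤g = ≤-refl
    ∑-mono-≤ (x ∷ xs) f≤g = +-mono-≤ (f≤g (here refl)) (∑-mono-≤ xs (f≤g ∘ there))

    ∑-nonNeg : ∀ xs {f : A → ℚ} → (∀ {x} → x ∈ xs → 0ℚ ≤ f x) → 0ℚ ≤ ∑ xs f
    ∑-nonNeg xs 0≤f = ≤-trans (≤-reflexive (sym (∑ℚ.∑-0 xs))) (∑-mono-≤ xs 0≤f)

  fromℕ-length-filter : ∀ {a p} {A : Set a} {P : Pred A p} (P? : Decidable P) xs →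
                        fromℕ (length (filter P? xs)) ≡ ∑[ x ← xs ] 𝟙 (does (P? x))
  fromℕ-length-filter P? []       = fromℕ-0
  fromℕ-length-filter P? (x ∷ xs) with P? x
  ... | yes _ = trans (fromℕ-+ 1 (length (filter P? xs))) (cong₂ _+_ fromℕ-1 (fromℕ-length-filter P? xs))
  ... | no  _ = trans (fromℕ-length-filter P? xs) (sym (+-identityˡ _))

module FlowBound where
  open import Data.Nat as ℕ using (ℕ)
  open import Data.Bool using (not)
  open import Data.Product using (_,_)
  open import Data.List using (List; []; _∷_; map)
  open import Data.List.Membership.Propositional using (_∈_; _∉_; find)
  open import Data.List.Relation.Unary.Any as Any using (Any; here; there; any?)
  open import Data.List.Relation.Unary.All using (All; []; _∷_)
  open import Data.List.Relation.Unary.All.Properties using (All¬⇒¬Any)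
  open import Data.List.Relation.Unary.AllPairs using ([]; _∷_)
  open import Data.List.Relation.Unary.Unique.Propositional using (Unique)
  import Data.List.Membership.DecPropositional as DecMembership
  open import Data.Fin.Subset using (Subset; _⊂_; _⊆_)
  open import Data.Fin.Subset.Properties using (_⊆?_; _⊂?_; ⊆-reflexive; ⊆-trans; ⊆-⊂-trans; p⊂q⇒p⊆q)
  open import Data.Vec.Properties using (≡-dec)
  import Data.Bool as Bool
  open import Data.Rational using (ℚ; 0ℚ; 1ℚ; _+_; _*_; _≤_)
  open import Data.Rational.Properties
  open import Relation.Nullary using (Dec; yes; no; does; ¬_; contradiction)
  open import Relation.Binary using (DecidableEquality)
  open import Relation.Binary.PropositionalEquality
  open import Function using (_∘_)
  open import Defs using (IsAntichain; IsLYM; rank; layerSize; inv; sumℚ)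
  open RationalArithmetic
  open ∑ℚ using (∑; ∑-cong; ∑-+; ∑-*ˡ; ∑-swap)

  module _ {a} {A : Set a} (_≟_ : DecidableEquality A) where
    open DecMembership _≟_ using (_∈?_)

    private
      𝟙-∈∷ : ∀ {a as} x → a ∉ as → 𝟙 (does (x ∈? a ∷ as)) ≡ 𝟙 (does (x ≟ a)) + 𝟙 (does (x ∈? as))
      𝟙-∈∷ {a} {as} x a∉as with x ≟ a | x ∈? as
      ... | yes refl | yes a∈as = contradiction a∈as a∉as
      ... | yes refl | no  _    = sym (+-identityʳ 1ℚ)
      ... | no  _    | yes _    = sym (+-identityˡ 1ℚ)
      ... | no  _    | no  _    = sym (+-identityˡ 0ℚ)

      term≤∑ : ∀ xs {a} (g : A → ℚ) → (∀ {x} → x ∈ xs → 0ℚ ≤ g x) → a ∈ xs →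
               g a ≤ ∑[ x ← xs ] (𝟙 (does (x ≟ a)) * g x)
      term≤∑ (x ∷ xs) g 0≤g (here refl) with x ≟ x
      ... | yes _ = begin
        g x                                        ≡⟨ *-identityˡ (g x) ⟨
        1ℚ * g x                                   ≡⟨ +-identityʳ _ ⟨
        1ℚ * g x + 0ℚ
          ≤⟨ +-monoʳ-≤ (1ℚ * g x) (∑-nonNeg xs (λ {y} y∈xs → 𝟙*-nonNeg (does (y ≟ x)) (0≤g (there y∈xs)))) ⟩
        1ℚ * g x + ∑[ y ← xs ] (𝟙 (does (y ≟ x)) * g y) ∎
        where open ≤-Reasoning
      ... | no x≢x = contradiction refl x≢x
      term≤∑ (x ∷ xs) {a} g 0≤g (there a∈xs) = begin
        g a                                        ≤⟨ term≤∑ xs g (0≤g ∘ there) a∈xs ⟩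
        ∑[ y ← xs ] (𝟙 (does (y ≟ a)) * g y)       ≡⟨ +-identityˡ _ ⟨
        0ℚ + ∑[ y ← xs ] (𝟙 (does (y ≟ a)) * g y)
          ≤⟨ +-monoˡ-≤ (∑[ y ← xs ] (𝟙 (does (y ≟ a)) * g y)) (𝟙*-nonNeg (does (x ≟ a)) (0≤g (here refl))) ⟩
        ∑[ y ← x ∷ xs ] (𝟙 (does (y ≟ a)) * g y)   ∎
        where open ≤-Reasoning

    ∑-sublist≤∑ : ∀ xs ys (g : A → ℚ) → (∀ {x} → x ∈ xs → 0ℚ ≤ g x) → Unique ys → All (_∈ xs) ys →
                  ∑ ys g ≤ ∑[ x ← xs ] (𝟙 (does (x ∈? ys)) * g x)
    ∑-sublist≤∑ xs []       g 0≤g _               _           = ∑-nonNeg xs (λ {x} _ → ≤-reflexive (sym (*-zeroˡ (g x))))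
    ∑-sublist≤∑ xs (y ∷ ys) g 0≤g (y≢ys ∷ unique) (y∈xs ∷ ys⊆xs) = begin
      g y + ∑ ys g
        ≤⟨ +-mono-≤ (term≤∑ xs g 0≤g y∈xs) (∑-sublist≤∑ xs ys g 0≤g unique ys⊆xs) ⟩
      ∑[ x ← xs ] (𝟙 (does (x ≟ y)) * g x) + ∑[ x ← xs ] (𝟙 (does (x ∈? ys)) * g x) ≡⟨ ∑-+ xs _ _ ⟨
      ∑[ x ← xs ] (𝟙 (does (x ≟ y)) * g x + 𝟙 (does (x ∈? ys)) * g x)
        ≡⟨ ∑-cong xs (λ {x} _ → trans (sym (*-distribʳ-+ (g x) (𝟙 (does (x ≟ y))) (𝟙 (does (x ∈? ys)))))
                                      (cong (_* g x) (sym (𝟙-∈∷ x (All¬⇒¬Any y≢ys))))) ⟩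
      ∑[ x ← xs ] (𝟙 (does (x ∈? y ∷ ys)) * g x)                                   ∎
      where open ≤-Reasoning

  module _ {n : ℕ} (P : List (Subset n)) where

    record Flow (μ σ : Subset n → ℚ) : Set where
      field
        flow        : Subset n → Subset n → ℚ
        flow-nonNeg : ∀ {x y} → x ∈ P → y ∈ P → 0ℚ ≤ flow x y
        flow-⊂      : ∀ {x y} → x ∈ P → y ∈ P → ¬ x ⊂ y → flow x y ≡ 0ℚ
        outflow≤    : ∀ {x} → x ∈ P → ∑[ y ← P ] flow x y ≤ μ x
        inflow      : ∀ {y} → y ∈ P → ∑[ x ← P ] flow x y + σ y ≡ μ y

    -- Cut P into the up-set generated by the antichain A and its complement: all flow
    -- into A crosses the cut, and what crosses the cut is at most the source mass of
    -- the complement.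
    module Cut {μ σ} (𝓕 : Flow μ σ) (A : List (Subset n)) (incomparable : ∀ {x y} → x ∈ A → y ∈ A → ¬ x ⊂ y) where
      open Flow 𝓕

      _≟ₛ_ : DecidableEquality (Subset n)
      _≟ₛ_ = ≡-dec Bool._≟_
      open DecMembership _≟ₛ_ public using (_∈?_)

      above? : ∀ x → Dec (Any (_⊆ x) A)
      above? x = any? (_⊆? x) A

      χ up down received : Subset n → ℚ
      χ x        = 𝟙 (does (x ∈? A))
      up x       = 𝟙 (does (above? x))
      down x     = 𝟙 (not (does (above? x)))
      received y = ∑[ x ← P ] flow x y

      down+up : ∀ (f : Subset n → ℚ) x → down x * f x + up x * f x ≡ f x
      down+up f x with above? x
      ... | yes _ = trans (cong (_+ 1ℚ * f x) (*-zeroˡ (f x))) (trans (+-identityˡ (1ℚ * f x)) (*-identityˡ (f x)))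
      ... | no  _ = trans (cong (1ℚ * f x +_) (*-zeroˡ (f x))) (trans (+-identityʳ (1ℚ * f x)) (*-identityˡ (f x)))

      χ≤up : ∀ x → χ x ≤ up x
      χ≤up x with x ∈? A | above? x
      ... | no  _   | x↑?      = 𝟙-nonNeg (does x↑?)
      ... | yes _   | yes _    = ≤-refl
      ... | yes x∈A | no  x∉up = contradiction (Any.map (⊆-reflexive ∘ sym) x∈A) x∉up

      private
        from-down : ∀ {x y} → x ∈ P → y ∈ P → (x ⊂ y → ¬ Any (_⊆ x) A) → flow x y ≡ down x * flow x y
        from-down {x} {y} x∈P y∈P x⊂y⇒down with x ⊂? y | above? x
        ... | no  x⊄y | x↑?     = trans (flow-⊂ x∈P y∈P x⊄y)
                                    (sym (trans (cong (𝟙 (not (does x↑?)) *_) (flow-⊂ x∈P y∈P x⊄y)) (*-zeroʳ (𝟙 (not (does x↑?))))))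
        ... | yes x⊂y | yes x↑  = contradiction x↑ (x⊂y⇒down x⊂y)
        ... | yes _   | no  _   = sym (*-identityˡ (flow x y))

      χ-flow : ∀ {x y} → x ∈ P → y ∈ P → χ y * flow x y ≡ χ y * (down x * flow x y)
      χ-flow {x} {y} x∈P y∈P with y ∈? A
      ... | no  _   = trans (*-zeroˡ (flow x y)) (sym (*-zeroˡ (down x * flow x y)))
      ... | yes y∈A = cong (1ℚ *_) (from-down x∈P y∈P λ x⊂y x↑ →
        let (a , a∈A , a⊆x) = find x↑ in incomparable a∈A y∈A (⊆-⊂-trans a⊆x x⊂y))

      down-flow : ∀ {x y} → x ∈ P → y ∈ P → down y * flow x y ≡ down y * (down x * flow x y)
      down-flow {x} {y} x∈P y∈P with above? y
      ... | yes _  = trans (*-zeroˡ (flow x y)) (sym (*-zeroˡ (down x * flow x y)))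
      ... | no  y↓ = cong (1ℚ *_) (from-down x∈P y∈P λ x⊂y x↑ →
        y↓ (Any.map {P = _⊆ x} {Q = _⊆ y} (λ a⊆x → ⊆-trans a⊆x (p⊂q⇒p⊆q x⊂y)) x↑))

      into-A within-down crossing : ℚ
      into-A      = ∑[ y ← P ] ∑[ x ← P ] (χ y * (down x * flow x y))
      within-down = ∑[ y ← P ] ∑[ x ← P ] (down y * (down x * flow x y))
      crossing    = ∑[ y ← P ] ∑[ x ← P ] (up y * (down x * flow x y))

      χ-received : ∀ {y} → y ∈ P → χ y * received y ≡ ∑[ x ← P ] (χ y * (down x * flow x y))
      χ-received {y} y∈P = trans (sym (∑-*ˡ P (χ y) (λ x → flow x y))) (∑-cong P (λ x∈P → χ-flow x∈P y∈P))

      down-received : ∀ {x} → x ∈ P → down x * received x ≡ ∑[ y ← P ] (down x * (down y * flow y x))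
      down-received {x} x∈P = trans (sym (∑-*ˡ P (down x) (λ y → flow y x))) (∑-cong P (λ y∈P → down-flow y∈P x∈P))

      into-A≤crossing : into-A ≤ crossing
      into-A≤crossing = ∑-mono-≤ P λ {y} y∈P → ∑-mono-≤ P λ {x} x∈P →
        *-monoʳ-≤-0≤ (𝟙*-nonNeg (not (does (above? x))) (flow-nonNeg x∈P y∈P)) (χ≤up y)

      crossing≤ : crossing ≤ ∑[ x ← P ] (down x * σ x)
      crossing≤ = +-cancelˡ-≤ within-down (begin
        within-down + crossing
          ≡⟨ ∑-+ P (λ y → ∑[ x ← P ] (down y * (down x * flow x y))) (λ y → ∑[ x ← P ] (up y * (down x * flow x y))) ⟨
        ∑[ y ← P ] (∑[ x ← P ] (down y * (down x * flow x y)) + ∑[ x ← P ] (up y * (down x * flow x y)))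
          ≡⟨ ∑-cong P (λ {y} _ → trans (sym (∑-+ P (λ x → down y * (down x * flow x y)) (λ x → up y * (down x * flow x y))))
                                       (∑-cong P (λ {x} _ → down+up (λ y → down x * flow x y) y))) ⟩
        ∑[ y ← P ] ∑[ x ← P ] (down x * flow x y)                     ≡⟨ ∑-swap P P (λ x y → down x * flow x y) ⟨
        ∑[ x ← P ] ∑[ y ← P ] (down x * flow x y)                     ≡⟨ ∑-cong P (λ {x} _ → ∑-*ˡ P (down x) (flow x)) ⟩
        ∑[ x ← P ] (down x * ∑[ y ← P ] flow x y)
          ≤⟨ ∑-mono-≤ P (λ {x} x∈P → *-monoˡ-≤-0≤ (𝟙-nonNeg (not (does (above? x)))) (outflow≤ x∈P)) ⟩
        ∑[ x ← P ] (down x * μ x)                                     ≡⟨ ∑-cong P (λ {x} x∈P → cong (down x *_) (sym (inflow x∈P))) ⟩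
        ∑[ x ← P ] (down x * (received x + σ x))                      ≡⟨ ∑-cong P (λ {x} _ → *-distribˡ-+ (down x) (received x) (σ x)) ⟩
        ∑[ x ← P ] (down x * received x + down x * σ x)               ≡⟨ ∑-+ P (λ x → down x * received x) (λ x → down x * σ x) ⟩
        ∑[ x ← P ] (down x * received x) + ∑[ x ← P ] (down x * σ x)  ≡⟨ cong (_+ ∑[ x ← P ] (down x * σ x)) (∑-cong P down-received) ⟩
        within-down + ∑[ x ← P ] (down x * σ x)                       ∎)
        where open ≤-Reasoning

    antichain-bound : ∀ {μ σ} → Flow μ σ → (∀ {x} → x ∈ P → 0ℚ ≤ μ x) → (∀ {x} → x ∈ P → 0ℚ ≤ σ x) →
                      ∀ A → IsAntichain P A → ∑ A μ ≤ ∑ P σ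
    antichain-bound {μ} {σ} 𝓕 0≤μ 0≤σ A (unique , A⊆P , incomparable) = begin
      ∑ A μ                                                     ≤⟨ ∑-sublist≤∑ _≟ₛ_ P A μ 0≤μ unique A⊆P ⟩
      ∑[ y ← P ] (χ y * μ y)                                    ≡⟨ ∑-cong P (λ {y} y∈P → cong (χ y *_) (sym (inflow y∈P))) ⟩
      ∑[ y ← P ] (χ y * (received y + σ y))                     ≡⟨ ∑-cong P (λ {y} _ → *-distribˡ-+ (χ y) (received y) (σ y)) ⟩
      ∑[ y ← P ] (χ y * received y + χ y * σ y)                 ≡⟨ ∑-+ P (λ y → χ y * received y) (λ y → χ y * σ y) ⟩
      ∑[ y ← P ] (χ y * received y) + ∑[ y ← P ] (χ y * σ y)    ≡⟨ cong (_+ ∑[ y ← P ] (χ y * σ y)) (∑-cong P χ-received) ⟩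
      into-A + ∑[ y ← P ] (χ y * σ y)
        ≤⟨ +-mono-≤ into-A≤crossing (∑-mono-≤ P (λ {y} y∈P → *-monoʳ-≤-0≤ (0≤σ y∈P) (χ≤up y))) ⟩
      crossing + ∑[ y ← P ] (up y * σ y)                        ≤⟨ +-monoˡ-≤ (∑[ y ← P ] (up y * σ y)) crossing≤ ⟩
      ∑[ x ← P ] (down x * σ x) + ∑[ x ← P ] (up x * σ x)       ≡⟨ ∑-+ P (λ x → down x * σ x) (λ x → up x * σ x) ⟨
      ∑[ x ← P ] (down x * σ x + up x * σ x)                    ≡⟨ ∑-cong P (λ {x} _ → down+up σ x) ⟩
      ∑ P σ                                                     ∎
      where
      open Flow 𝓕
      open Cut 𝓕 A incomparable
      open ≤-Reasoning

    layerWeight sourceWeight : Subset n → ℚ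
    layerWeight x  = inv (layerSize P (rank P x))
    sourceWeight x = 𝟙 (does (rank P x ℕ.≟ 0)) * layerWeight x

    Flow⇒IsLYM : Flow layerWeight sourceWeight → IsLYM P
    Flow⇒IsLYM 𝓕 A antichain = begin
      sumℚ (map layerWeight A)                         ≡⟨ sumℚ-map A layerWeight ⟩
      ∑ A layerWeight                                  ≤⟨ antichain-bound 𝓕 (λ {x} _ → layerWeight-nonNeg x) (λ {x} _ → sourceWeight-nonNeg x) A antichain ⟩
      ∑ P sourceWeight                                 ≡⟨ ∑-cong P (λ {x} _ → bottom x) ⟩
      ∑[ x ← P ] (inv L₀ * 𝟙 (does (rank P x ℕ.≟ 0)))  ≡⟨ ∑-*ˡ P (inv L₀) (λ x → 𝟙 (does (rank P x ℕ.≟ 0))) ⟩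
      inv L₀ * ∑[ x ← P ] 𝟙 (does (rank P x ℕ.≟ 0))    ≡⟨ cong (inv L₀ *_) (fromℕ-length-filter (λ x → rank P x ℕ.≟ 0) P) ⟨
      inv L₀ * fromℕ L₀                                ≤⟨ inv*fromℕ≤1 L₀ ⟩
      1ℚ                                               ∎
      where
      open ≤-Reasoning
      L₀ = layerSize P 0

      layerWeight-nonNeg : ∀ x → 0ℚ ≤ layerWeight x
      layerWeight-nonNeg x = inv-nonNeg (layerSize P (rank P x))

      sourceWeight-nonNeg : ∀ x → 0ℚ ≤ sourceWeight x
      sourceWeight-nonNeg x = 𝟙*-nonNeg (does (rank P x ℕ.≟ 0)) (layerWeight-nonNeg x)

      sumℚ-map : ∀ xs (f : Subset n → ℚ) → sumℚ (map f xs) ≡ ∑ xs f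
      sumℚ-map []       f = refl
      sumℚ-map (x ∷ xs) f = cong (f x +_) (sumℚ-map xs f)

      bottom′ : ∀ r (r≟0 : Dec (r ≡ 0)) → 𝟙 (does r≟0) * inv (layerSize P r) ≡ inv L₀ * 𝟙 (does r≟0)
      bottom′ r (yes refl) = *-comm 1ℚ (inv L₀)
      bottom′ r (no  _)    = trans (*-zeroˡ (inv (layerSize P r))) (sym (*-zeroʳ (inv L₀)))

      bottom : ∀ x → sourceWeight x ≡ inv L₀ * 𝟙 (does (rank P x ℕ.≟ 0))
      bottom x = bottom′ (rank P x) (rank P x ℕ.≟ 0)

module CubeCounting where
  open import Data.Nat
  open import Data.Nat.Properties
  open import Data.Nat.Combinatorics using (_C_; nCk+nC[k+1]≡[n+1]C[k+1])
  open import Data.Bool using (Bool; true; false; not; _∧_)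
  import Data.Bool as Bool
  open import Data.Vec using ([]; _∷_)
  open import Data.Vec.Properties using (≡-dec)
  open import Data.List using ([]; _∷_)
  open import Data.List.Membership.Propositional using (_∈_)
  open import Data.List.Membership.Propositional.Properties using (∈-concatMap⁺)
  open import Data.List.Relation.Unary.Any as Any using (here; there)
  open import Data.Fin.Subset using (Subset; inside; outside; _⊂_; ∣_∣)
  open import Data.Fin.Subset.Properties using (out⊂in; s⊂s; ⊆-refl)
  open import Data.Product using (_×_; _,_; ∃; proj₁; proj₂)
  open import Function using (_∘_)
  open import Relation.Nullary using (does; yes; no; contradiction)
  open import Relation.Nullary.Decidable using (dec-true)
  open import Relation.Binary using (DecidableEquality)
  open import Relation.Binary.PropositionalEquality
  open import Algebra.Properties.CommutativeSemigroup +-commutativeSemigroup using (x∙yz≈y∙xz)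
  open import Defs using (allSubsets; hammingDist)
  open FiniteSums +-*-commutativeSemiring using (∑; ∑-cong; ∑-0; ∑-+; ∑-*ˡ; ∑-concatMap)

  𝟙ℕ : Bool → ℕ
  𝟙ℕ true  = 1
  𝟙ℕ false = 0

  _≟ₛ_ : ∀ {n} → DecidableEquality (Subset n)
  _≟ₛ_ = ≡-dec Bool._≟_

  -- Side s of the centre c is c itself for s = true and its complement for s = false;
  -- count s c x and missing s c x are |x ∩ side| and |side ∖ x|.
  onSide : Bool → Bool → Bool
  onSide true  e = e
  onSide false e = not e

  count missing : ∀ {n} → Bool → Subset n → Subset n → ℕ
  count s []      []          = 0
  count s (e ∷ c) (true  ∷ x) = 𝟙ℕ (onSide s e) + count s c x
  count s (e ∷ c) (false ∷ x) = count s c x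

  missing s []      []          = 0
  missing s (e ∷ c) (true  ∷ x) = missing s c x
  missing s (e ∷ c) (false ∷ x) = 𝟙ℕ (onSide s e) + missing s c x

  sideSize : ∀ {n} → Bool → Subset n → ℕ
  sideSize s []      = 0
  sideSize s (e ∷ c) = 𝟙ℕ (onSide s e) + sideSize s c

  -- step s c x y: y is x together with one more point on side s.
  step : ∀ {n} → Bool → Subset n → Subset n → Subset n → Bool
  step s []      []          []          = false
  step s (e ∷ c) (false ∷ x) (true  ∷ y) = onSide s e ∧ does (x ≟ₛ y)
  step s (e ∷ c) (false ∷ x) (false ∷ y) = step s c x y
  step s (e ∷ c) (true  ∷ x) (true  ∷ y) = step s c x y
  step s (e ∷ c) (true  ∷ x) (false ∷ y) = false

  count+missing : ∀ {n} s (c x : Subset n) → count s c x + missing s c x ≡ sideSize s c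
  count+missing s []      []          = refl
  count+missing s (e ∷ c) (true  ∷ x) = trans (+-assoc (𝟙ℕ (onSide s e)) _ _) (cong (𝟙ℕ (onSide s e) +_) (count+missing s c x))
  count+missing s (e ∷ c) (false ∷ x) = begin
    count s c x + (𝟙ℕ (onSide s e) + missing s c x)   ≡⟨ x∙yz≈y∙xz (count s c x) (𝟙ℕ (onSide s e)) (missing s c x) ⟩
    𝟙ℕ (onSide s e) + (count s c x + missing s c x)   ≡⟨ cong (𝟙ℕ (onSide s e) +_) (count+missing s c x) ⟩
    𝟙ℕ (onSide s e) + sideSize s c                    ∎
    where
    open ≡-Reasoning

  hammingDist≡missing+count : ∀ {n} (c x : Subset n) → hammingDist x c ≡ missing true c x + count false c x
  hammingDist≡missing+count []          []          = refl
  hammingDist≡missing+count (true  ∷ c) (true  ∷ x) = hammingDist≡missing+count c x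
  hammingDist≡missing+count (true  ∷ c) (false ∷ x) = cong suc (hammingDist≡missing+count c x)
  hammingDist≡missing+count (false ∷ c) (true  ∷ x) = trans (cong suc (hammingDist≡missing+count c x)) (sym (+-suc _ _))
  hammingDist≡missing+count (false ∷ c) (false ∷ x) = hammingDist≡missing+count c x

  ∣x∣≡count+count : ∀ {n} (c x : Subset n) → ∣ x ∣ ≡ count true c x + count false c x
  ∣x∣≡count+count []          []          = refl
  ∣x∣≡count+count (true  ∷ c) (true  ∷ x) = cong suc (∣x∣≡count+count c x)
  ∣x∣≡count+count (true  ∷ c) (false ∷ x) = ∣x∣≡count+count c x
  ∣x∣≡count+count (false ∷ c) (true  ∷ x) = trans (cong suc (∣x∣≡count+count c x)) (sym (+-suc _ _))
  ∣x∣≡count+count (false ∷ c) (false ∷ x) = ∣x∣≡count+count c x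

  private
    onSide-not : ∀ s e → onSide s e ≡ true → onSide (not s) e ≡ false
    onSide-not true  true  _ = refl
    onSide-not false false _ = refl

    step-head : ∀ {n} s e (x y : Subset n) → onSide s e ∧ does (x ≟ₛ y) ≡ true → onSide s e ≡ true × x ≡ y
    step-head s e x y h with onSide s e | x ≟ₛ y
    step-head s e x y h  | true  | yes x≡y = refl , x≡y
    step-head s e x y () | true  | no  _
    step-head s e x y () | false | _

  step⇒⊂ : ∀ {n} s (c x y : Subset n) → step s c x y ≡ true → x ⊂ y
  step⇒⊂ s []      []          []          ()
  step⇒⊂ s (e ∷ c) (false ∷ x) (true  ∷ y) h with step-head s e x y h
  ... | _ , refl = out⊂in ⊆-refl
  step⇒⊂ s (e ∷ c) (false ∷ x) (false ∷ y) h = s⊂s (step⇒⊂ s c x y h)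
  step⇒⊂ s (e ∷ c) (true  ∷ x) (true  ∷ y) h = s⊂s (step⇒⊂ s c x y h)

  step⇒count : ∀ {n} s (c x y : Subset n) → step s c x y ≡ true →
               count s c y ≡ suc (count s c x) × count (not s) c y ≡ count (not s) c x
  step⇒count s []      []          []          ()
  step⇒count s (e ∷ c) (false ∷ x) (true  ∷ y) h with step-head s e x y h
  ... | on , refl rewrite on | onSide-not s e on = refl , refl
  step⇒count s (e ∷ c) (false ∷ x) (false ∷ y) h = step⇒count s c x y h
  step⇒count s (e ∷ c) (true  ∷ x) (true  ∷ y) h =
    let (this , other) = step⇒count s c x y h
    in trans (cong (𝟙ℕ (onSide s e) +_) this) (+-suc _ _) , cong (𝟙ℕ (onSide (not s) e) +_) other

  step-exclusive : ∀ {n} (c x y : Subset n) → step true c x y ≡ true → step false c x y ≡ false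
  step-exclusive c x y inside-step with step false c x y in outside-step
  ... | false = refl
  ... | true  = contradiction (trans (sym (proj₂ (step⇒count false c x y outside-step)))
                                     (proj₁ (step⇒count true c x y inside-step))) (1+n≢n ∘ sym)

  ∈-allSubsets : ∀ {n} (x : Subset n) → x ∈ allSubsets n
  ∈-allSubsets []      = here refl
  ∈-allSubsets (e ∷ x) = ∈-concatMap⁺ (λ s → (outside ∷ s) ∷ (inside ∷ s) ∷ []) (Any.map (λ { refl → extend e }) (∈-allSubsets x))
    where
    extend : ∀ e → e ∷ x ∈ (outside ∷ x) ∷ (inside ∷ x) ∷ []
    extend false = here refl
    extend true  = there (here refl)

  ∑-allSubsets-suc : ∀ n (f : Subset (suc n) → ℕ) →
                     ∑ (allSubsets (suc n)) f ≡ ∑[ x ← allSubsets n ] (f (false ∷ x) + f (true ∷ x))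
  ∑-allSubsets-suc n f = trans (∑-concatMap (λ x → (outside ∷ x) ∷ (inside ∷ x) ∷ []) (allSubsets n) f)
    (∑-cong (allSubsets n) (λ {x} _ → cong (f (false ∷ x) +_) (+-identityʳ (f (true ∷ x)))))

  private
    #≡ˡ : ∀ {n} (x : Subset n) → ∑[ y ← allSubsets n ] 𝟙ℕ (does (x ≟ₛ y)) ≡ 1
    #≡ˡ []              = refl
    #≡ˡ {suc n} (true  ∷ x) = trans (∑-allSubsets-suc n _) (#≡ˡ x)
    #≡ˡ {suc n} (false ∷ x) = trans (∑-allSubsets-suc n _)
      (trans (∑-cong (allSubsets n) (λ {y} _ → +-identityʳ (𝟙ℕ (does (x ≟ₛ y))))) (#≡ˡ x))

    #≡ʳ : ∀ {n} (y : Subset n) → ∑[ x ← allSubsets n ] 𝟙ℕ (does (x ≟ₛ y)) ≡ 1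
    #≡ʳ []              = refl
    #≡ʳ {suc n} (true  ∷ y) = trans (∑-allSubsets-suc n _) (#≡ʳ y)
    #≡ʳ {suc n} (false ∷ y) = trans (∑-allSubsets-suc n _)
      (trans (∑-cong (allSubsets n) (λ {x} _ → +-identityʳ (𝟙ℕ (does (x ≟ₛ y))))) (#≡ʳ y))

    #∧ : ∀ {n} b (g : Subset n → Bool) → ∑[ x ← allSubsets n ] 𝟙ℕ (g x) ≡ 1 → ∑[ x ← allSubsets n ] 𝟙ℕ (b ∧ g x) ≡ 𝟙ℕ b
    #∧ true  g #g≡1 = #g≡1
    #∧ {n} false g _ = ∑-0 (allSubsets n)

  #upperSteps : ∀ {n} s (c x : Subset n) → ∑[ y ← allSubsets n ] 𝟙ℕ (step s c x y) ≡ missing s c x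
  #upperSteps s []      []                  = refl
  #upperSteps {suc n} s (e ∷ c) (true  ∷ x) = trans (∑-allSubsets-suc n _) (#upperSteps s c x)
  #upperSteps {suc n} s (e ∷ c) (false ∷ x) = trans (∑-allSubsets-suc n _) (trans (∑-+ (allSubsets n) _ _)
    (trans (cong₂ _+_ (#upperSteps s c x) (#∧ (onSide s e) (λ y → does (x ≟ₛ y)) (#≡ˡ x))) (+-comm (missing s c x) _)))

  #lowerSteps : ∀ {n} s (c y : Subset n) → ∑[ x ← allSubsets n ] 𝟙ℕ (step s c x y) ≡ count s c y
  #lowerSteps s []      []                  = refl
  #lowerSteps {suc n} s (e ∷ c) (false ∷ y) = trans (∑-allSubsets-suc n _)
    (trans (∑-cong (allSubsets n) (λ {x} _ → +-identityʳ (𝟙ℕ (step s c x y)))) (#lowerSteps s c y))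
  #lowerSteps {suc n} s (e ∷ c) (true  ∷ y) = trans (∑-allSubsets-suc n _) (trans (∑-+ (allSubsets n) _ _)
    (cong₂ _+_ (#∧ (onSide s e) (λ x → does (x ≟ₛ y)) (#≡ʳ y)) (#lowerSteps s c y)))

  lowerStep : ∀ {n} s (c y : Subset n) → 0 < count s c y → ∃ λ x → step s c x y ≡ true
  lowerStep s []      []          ()
  lowerStep s (e ∷ c) (false ∷ y) 0<count = let (x , x→y) = lowerStep s c y 0<count in false ∷ x , x→y
  lowerStep s (e ∷ c) (true  ∷ y) 0<count with onSide s e in on
  ... | true  = false ∷ y , trans (cong (_∧ does (y ≟ₛ y)) on) (dec-true (y ≟ₛ y) refl)
  ... | false = let (x , x→y) = lowerStep s c y 0<count in true ∷ x , x→y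

  #type≡C*C : ∀ {n} (c : Subset n) u b →
              ∑[ x ← allSubsets n ] (𝟙ℕ (count true c x ≡ᵇ u) * 𝟙ℕ (count false c x ≡ᵇ b)) ≡
              (sideSize true c C u) * (sideSize false c C b)
  #type≡C*C []      zero    zero    = refl
  #type≡C*C []      zero    (suc b) = refl
  #type≡C*C []      (suc u) b       = refl
  #type≡C*C {suc n} (true ∷ c) u b = trans (∑-allSubsets-suc n _) (trans (∑-+ (allSubsets n) _ _) (pascal u))
    where
    pascal : ∀ u → ∑[ x ← allSubsets n ] (𝟙ℕ (count true c x ≡ᵇ u) * 𝟙ℕ (count false c x ≡ᵇ b))
                 + ∑[ x ← allSubsets n ] (𝟙ℕ (suc (count true c x) ≡ᵇ u) * 𝟙ℕ (count false c x ≡ᵇ b))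
                 ≡ (suc (sideSize true c) C u) * (sideSize false c C b)
    pascal zero    = trans (cong₂ _+_ (#type≡C*C c zero b) (∑-0 (allSubsets n))) (+-identityʳ _)
    pascal (suc u) = begin
      ∑[ x ← allSubsets n ] (𝟙ℕ (count true c x ≡ᵇ suc u) * 𝟙ℕ (count false c x ≡ᵇ b))
        + ∑[ x ← allSubsets n ] (𝟙ℕ (count true c x ≡ᵇ u) * 𝟙ℕ (count false c x ≡ᵇ b))
                                                                    ≡⟨ cong₂ _+_ (#type≡C*C c (suc u) b) (#type≡C*C c u b) ⟩
      (p C suc u) * (q C b) + (p C u) * (q C b)                    ≡⟨ +-comm ((p C suc u) * (q C b)) _ ⟩
      (p C u) * (q C b) + (p C suc u) * (q C b)                    ≡⟨ *-distribʳ-+ (q C b) (p C u) (p C suc u) ⟨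
      ((p C u) + (p C suc u)) * (q C b)                            ≡⟨ cong (_* (q C b)) (nCk+nC[k+1]≡[n+1]C[k+1] p u) ⟩
      (suc p C suc u) * (q C b)                                    ∎
      where
      open ≡-Reasoning
      p = sideSize true c
      q = sideSize false c
  #type≡C*C {suc n} (false ∷ c) u b = trans (∑-allSubsets-suc n _) (trans (∑-+ (allSubsets n) _ _) (pascal b))
    where
    pascal : ∀ b → ∑[ x ← allSubsets n ] (𝟙ℕ (count true c x ≡ᵇ u) * 𝟙ℕ (count false c x ≡ᵇ b))
                 + ∑[ x ← allSubsets n ] (𝟙ℕ (count true c x ≡ᵇ u) * 𝟙ℕ (suc (count false c x) ≡ᵇ b))
                 ≡ (sideSize true c C u) * (suc (sideSize false c) C b)
    pascal zero    = trans (cong₂ _+_ (#type≡C*C c u zero)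
                                      (trans (∑-cong (allSubsets n) (λ {x} _ → *-zeroʳ (𝟙ℕ (count true c x ≡ᵇ u)))) (∑-0 (allSubsets n))))
                           (+-identityʳ _)
    pascal (suc b) = begin
      ∑[ x ← allSubsets n ] (𝟙ℕ (count true c x ≡ᵇ u) * 𝟙ℕ (count false c x ≡ᵇ suc b))
        + ∑[ x ← allSubsets n ] (𝟙ℕ (count true c x ≡ᵇ u) * 𝟙ℕ (count false c x ≡ᵇ b))
                                                                    ≡⟨ cong₂ _+_ (#type≡C*C c u (suc b)) (#type≡C*C c u b) ⟩
      (p C u) * (q C suc b) + (p C u) * (q C b)                    ≡⟨ +-comm ((p C u) * (q C suc b)) _ ⟩
      (p C u) * (q C b) + (p C u) * (q C suc b)                    ≡⟨ *-distribˡ-+ (p C u) (q C b) (q C suc b) ⟨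
      (p C u) * ((q C b) + (q C suc b))                            ≡⟨ cong ((p C u) *_) (nCk+nC[k+1]≡[n+1]C[k+1] q b) ⟩
      (p C u) * (suc q C suc b)                                    ∎
      where
      open ≡-Reasoning
      p = sideSize true c
      q = sideSize false c

module PrefixSums where
  open import Data.Nat
  open import Data.Nat.Properties
  open import Relation.Binary.PropositionalEquality
  open FiniteSums +-*-commutativeSemiring public using (∑<; ∑<-cong; ∑<-*ˡ; ∑<-+; ∑<-suc)

  ∑<-mono-≤ : ∀ t {f g : ℕ → ℕ} → (∀ u → u < t → f u ≤ g u) → ∑< t f ≤ ∑< t g
  ∑<-mono-≤ zero    f≤g = z≤n
  ∑<-mono-≤ (suc t) f≤g = +-mono-≤ (∑<-mono-≤ t (λ u u<t → f≤g u (m<n⇒m<1+n u<t))) (f≤g t (n<1+n t))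

  ∑<-monoˡ-≤ : ∀ {s t} (f : ℕ → ℕ) → s ≤ t → ∑< s f ≤ ∑< t f
  ∑<-monoˡ-≤ {s} {t} f s≤t = begin
    ∑< s f                                  ≤⟨ m≤m+n (∑< s f) _ ⟩
    ∑< s f + ∑[ i < t ∸ s ] f (s + i)       ≡⟨ ∑<-+ s (t ∸ s) f ⟨
    ∑< (s + (t ∸ s)) f                      ≡⟨ cong (λ m → ∑< m f) (m+[n∸m]≡n s≤t) ⟩
    ∑< t f                                  ∎
    where open ≤-Reasoning

  term≤∑< : ∀ {u t} (f : ℕ → ℕ) → u < t → f u ≤ ∑< t f
  term≤∑< {u} f u<t = ≤-trans (m≤n+m (f u) (∑< u f)) (∑<-monoˡ-≤ f u<t)

  ∑<*∑< : ∀ s t (f g : ℕ → ℕ) → ∑< s f * ∑< t g ≡ ∑[ u < s ] ∑[ v < t ] (f u * g v)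
  ∑<*∑< s t f g = trans (*-comm (∑< s f) _) (trans (sym (∑<-*ˡ s (∑< t g) f))
    (∑<-cong s (λ u _ → trans (*-comm (∑< t g) (f u)) (sym (∑<-*ˡ t (f u) g)))))

  prefix-ratio-antitone : ∀ (f g : ℕ → ℕ) {s t} → s ≤ t → (∀ u v → u < v → g u * f v ≤ f u * g v) →
                          ∑< s g * ∑< t f ≤ ∑< s f * ∑< t g
  prefix-ratio-antitone f g {s} {t} s≤t tp rewrite sym (m+[n∸m]≡n s≤t) = begin
    G * ∑< (s + d) f                 ≡⟨ cong (G *_) (∑<-+ s d f) ⟩
    G * (F + ∑[ i < d ] f (s + i))   ≡⟨ *-distribˡ-+ G F _ ⟩
    G * F + G * ∑[ i < d ] f (s + i) ≤⟨ +-mono-≤ (≤-reflexive (*-comm G F)) cross ⟩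
    F * G + F * ∑[ i < d ] g (s + i) ≡⟨ *-distribˡ-+ F G _ ⟨
    F * (G + ∑[ i < d ] g (s + i))   ≡⟨ cong (F *_) (∑<-+ s d g) ⟨
    F * ∑< (s + d) g                 ∎
    where
    open ≤-Reasoning
    d = t ∸ s
    F = ∑< s f
    G = ∑< s g
    cross : G * ∑[ i < d ] f (s + i) ≤ F * ∑[ i < d ] g (s + i)
    cross = begin
      G * ∑[ i < d ] f (s + i)                          ≡⟨ ∑<*∑< s d g (λ i → f (s + i)) ⟩
      ∑[ u < s ] ∑[ i < d ] (g u * f (s + i))
        ≤⟨ ∑<-mono-≤ s (λ u u<s → ∑<-mono-≤ d (λ i _ → tp u (s + i) (≤-trans u<s (m≤m+n s i)))) ⟩
      ∑[ u < s ] ∑[ i < d ] (f u * g (s + i))           ≡⟨ ∑<*∑< s d f (λ i → g (s + i)) ⟨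
      F * ∑[ i < d ] g (s + i)                          ∎

module LayerProfile (p q ρ : ℕ) where
  open import Data.Nat
  open import Data.Nat.Properties
  open import Data.Nat.Combinatorics using (_C_; k>n⇒nCk≡0)
  open import Data.Nat.Solver using (module +-*-Solver)
  open import Data.Bool using (if_then_else_)
  open import Data.Product using (_×_; _,_)
  open import Relation.Nullary using (Dec; yes; no; does; ¬_)
  open import Relation.Nullary.Decidable using (_×-dec_; dec-true; dec-false)
  open import Relation.Binary.PropositionalEquality
  open Binomial
  open PrefixSums
  open +-*-Solver

  m∸n≤o⇒m∸o≤n : ∀ {m n o} → m ∸ n ≤ o → m ∸ o ≤ n
  m∸n≤o⇒m∸o≤n {m} {n} {o} m∸n≤o = m≤n+o⇒m∸n≤o m o (≤-trans (m≤n+m∸n m n) (≤-trans (+-monoʳ-≤ n m∸n≤o) (≤-reflexive (+-comm n o))))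

  -- A set of size k meeting the centre {1,…,p} of B_ρ[p,q] in u points lies in the
  -- ball iff Admissible k u; W k u counts these sets and N k is the size of level k.
  Admissible : ℕ → ℕ → Set
  Admissible k u = u ≤ k × p ∸ u + (k ∸ u) ≤ ρ

  -- Opaque: otherwise does (admissible? k u) reduces to a conjunction of ≤ᵇ tests,
  -- which `with` can no longer abstract.
  opaque
    admissible? : ∀ k u → Dec (Admissible k u)
    admissible? k u = u ≤? k ×-dec p ∸ u + (k ∸ u) ≤? ρ

  opaque
    W : ℕ → ℕ → ℕ
    W k u = if does (admissible? k u) then (p C u) * (q C (k ∸ u)) else 0

    W-admissible : ∀ {k u} → Admissible k u → W k u ≡ (p C u) * (q C (k ∸ u))
    W-admissible {k} {u} adm = cong (λ b → if b then (p C u) * (q C (k ∸ u)) else 0) (dec-true (admissible? k u) adm)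

    W-inadmissible : ∀ {k u} → ¬ Admissible k u → W k u ≡ 0
    W-inadmissible {k} {u} ¬adm = cong (λ b → if b then (p C u) * (q C (k ∸ u)) else 0) (dec-false (admissible? k u) ¬adm)

  W< : ℕ → ℕ → ℕ
  W< k t = ∑[ u < t ] W k u

  N : ℕ → ℕ
  N k = W< k (suc p)

  admissible-type : ∀ {u b} → p ∸ u + b ≤ ρ → Admissible (u + b) u
  admissible-type {u} {b} dist≤ρ = m≤m+n u b , subst (λ b′ → p ∸ u + b′ ≤ ρ) (sym (m+n∸m≡n u b)) dist≤ρ

  admissible⇒p∸ρ≤k : ∀ {k u} → Admissible k u → p ∸ ρ ≤ k
  admissible⇒p∸ρ≤k (u≤k , dist≤ρ) = ≤-trans (m∸n≤o⇒m∸o≤n (≤-trans (m≤m+n _ _) dist≤ρ)) u≤k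

  0<W : ∀ {k u} → Admissible k u → u ≤ p → k ∸ u ≤ q → 0 < W k u
  0<W adm u≤p k∸u≤q rewrite W-admissible adm = *-mono-≤ (0<nCk u≤p) (0<nCk k∸u≤q)

  W≤N : ∀ k {u} → u ≤ p → W k u ≤ N k
  W≤N k u≤p = term≤∑< (W k) (s≤s u≤p)

  0<N : ∀ {k u} → Admissible k u → u ≤ p → k ∸ u ≤ q → 0 < N k
  0<N {k} adm u≤p k∸u≤q = ≤-trans (0<W adm u≤p k∸u≤q) (W≤N k u≤p)

  0<N-below : ∀ {k u} → Admissible (suc k) u → u ≤ p → suc k ∸ u ≤ q → p ∸ ρ ≤ k → 0 < N k
  0<N-below {k} {u} (_ , dist≤ρ) u≤p b≤q p∸ρ≤k with u ≤? k
  ... | yes u≤k = 0<N (u≤k , ≤-trans (+-monoʳ-≤ (p ∸ u) (∸-monoˡ-≤ u (n≤1+n k))) dist≤ρ) u≤p (≤-trans (∸-monoˡ-≤ u (n≤1+n k)) b≤q)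
  ... | no  u≰k = 0<N {k} {k} (≤-refl , subst (_≤ ρ) (sym (trans (cong (p ∸ k +_) (n∸n≡0 k)) (+-identityʳ (p ∸ k)))) (m∸n≤o⇒m∸o≤n p∸ρ≤k))
                          (≤-trans (<⇒≤ (≰⇒> u≰k)) u≤p) (≤-trans (≤-reflexive (n∸n≡0 k)) z≤n)

  p<u⇒W≡0 : ∀ k {u} → p < u → W k u ≡ 0
  p<u⇒W≡0 k {u} p<u with admissible? k u
  ... | yes adm  = trans (W-admissible adm) (cong (_* (q C (k ∸ u))) (k>n⇒nCk≡0 p<u))
  ... | no  ¬adm = W-inadmissible ¬adm

  N≡0⇒W≡0 : ∀ {k} → N k ≡ 0 → ∀ u → W k u ≡ 0
  N≡0⇒W≡0 {k} N≡0 u with u ≤? p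
  ... | yes u≤p = n≤0⇒n≡0 (subst (W k u ≤_) N≡0 (W≤N k u≤p))
  ... | no  u≰p = p<u⇒W≡0 k (≰⇒> u≰p)

  W-level : ∀ k {u v} → u < v → W (suc k) u * W k v ≤ W k u * W (suc k) v
  W-level k {u} {v} u<v with admissible? (suc k) u | admissible? k v
  ... | no ¬adm | _ rewrite W-inadmissible ¬adm = z≤n
  ... | yes _ | no ¬adm rewrite W-inadmissible ¬adm | *-zeroʳ (W (suc k) u) = z≤n
  ... | yes adm₁@(u≤1+k , dist₁) | yes adm₂@(v≤k , _) = begin
    W (suc k) u * W k v                                        ≡⟨ cong₂ _*_ (W-admissible adm₁) (W-admissible adm₂) ⟩
    (p C u) * (q C (suc k ∸ u)) * ((p C v) * (q C (k ∸ v)))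
      ≡⟨ cong (λ m → (p C u) * (q C m) * ((p C v) * (q C (k ∸ v)))) (+-∸-assoc 1 u≤k) ⟩
    (p C u) * (q C suc b) * ((p C v) * (q C a))
      ≡⟨ solve 4 (λ x y z t → x :* y :* (z :* t) := x :* z :* (t :* y)) refl (p C u) (q C suc b) (p C v) (q C a) ⟩
    (p C u) * (p C v) * ((q C a) * (q C suc b))
      ≤⟨ *-monoʳ-≤ ((p C u) * (p C v)) (nCa*nC[1+b]≤nC[1+a]*nCb q (∸-monoʳ-≤ k (<⇒≤ u<v))) ⟩
    (p C u) * (p C v) * ((q C suc a) * (q C b))
      ≡⟨ solve 4 (λ x z s t → x :* z :* (s :* t) := x :* t :* (z :* s)) refl (p C u) (p C v) (q C suc a) (q C b) ⟩
    (p C u) * (q C b) * ((p C v) * (q C suc a))                ≡⟨ cong (λ m → (p C u) * (q C b) * ((p C v) * (q C m))) (+-∸-assoc 1 v≤k) ⟨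
    (p C u) * (q C (k ∸ u)) * ((p C v) * (q C (suc k ∸ v)))    ≡⟨ cong₂ _*_ (W-admissible adm₃) (W-admissible adm₄) ⟨
    W k u * W (suc k) v                                        ∎
    where
    open ≤-Reasoning
    a = k ∸ v
    b = k ∸ u
    u≤k = ≤-trans (<⇒≤ u<v) v≤k
    adm₃ : Admissible k u
    adm₃ = u≤k , ≤-trans (+-monoʳ-≤ (p ∸ u) (∸-monoˡ-≤ u (n≤1+n k))) dist₁
    adm₄ : Admissible (suc k) v
    adm₄ = m≤n⇒m≤1+n v≤k , ≤-trans (+-mono-≤ (∸-monoʳ-≤ p (<⇒≤ u<v)) (∸-monoʳ-≤ (suc k) (<⇒≤ u<v))) dist₁

  W-diagonal : ∀ k {u v} → u < v → W k u * W (suc k) (suc v) ≤ W (suc k) (suc u) * W k v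
  W-diagonal k {u} {v} u<v with admissible? k u | admissible? (suc k) (suc v)
  ... | no ¬adm | _ rewrite W-inadmissible ¬adm = z≤n
  ... | yes _ | no ¬adm rewrite W-inadmissible ¬adm | *-zeroʳ (W k u) = z≤n
  ... | yes adm₁@(u≤k , dist₁) | yes adm₂@(s≤s v≤k , _) = begin
    W k u * W (suc k) (suc v)                                  ≡⟨ cong₂ _*_ (W-admissible adm₁) (W-admissible adm₂) ⟩
    (p C u) * (q C b) * ((p C suc v) * (q C a))
      ≡⟨ solve 4 (λ x y z t → x :* y :* (z :* t) := x :* z :* (y :* t)) refl (p C u) (q C b) (p C suc v) (q C a) ⟩
    (p C u) * (p C suc v) * ((q C b) * (q C a))                ≤⟨ *-monoˡ-≤ ((q C b) * (q C a)) (nCa*nC[1+b]≤nC[1+a]*nCb p (<⇒≤ u<v)) ⟩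
    (p C suc u) * (p C v) * ((q C b) * (q C a))
      ≡⟨ solve 4 (λ x z y t → x :* z :* (y :* t) := x :* y :* (z :* t)) refl (p C suc u) (p C v) (q C b) (q C a) ⟩
    (p C suc u) * (q C b) * ((p C v) * (q C a))                ≡⟨ cong₂ _*_ (W-admissible adm₃) (W-admissible adm₄) ⟨
    W (suc k) (suc u) * W k v                                  ∎
    where
    open ≤-Reasoning
    a = k ∸ v
    b = k ∸ u
    adm₃ : Admissible (suc k) (suc u)
    adm₃ = s≤s u≤k , ≤-trans (+-monoˡ-≤ (k ∸ u) (∸-monoʳ-≤ p (n≤1+n u))) dist₁
    adm₄ : Admissible k v
    adm₄ = v≤k , ≤-trans (+-mono-≤ (∸-monoʳ-≤ p (<⇒≤ u<v)) (∸-monoʳ-≤ k (<⇒≤ u<v))) dist₁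

  W<-level : ∀ k {t} → t ≤ suc p → W< (suc k) t * N k ≤ W< k t * N (suc k)
  W<-level k t≤ = prefix-ratio-antitone (W k) (W (suc k)) t≤ (λ _ _ → W-level k)

  W<-diagonal : ∀ k {t} → t ≤ p → W< k t * N (suc k) ≤ W< (suc k) (suc t) * N k
  W<-diagonal k {t} t≤p = begin
    W< k t * N (suc k)                                   ≡⟨ cong (W< k t *_) (∑<-suc p (W (suc k))) ⟩
    W< k t * (W (suc k) 0 + ∑< p shifted)                ≡⟨ *-distribˡ-+ (W< k t) _ _ ⟩
    W< k t * W (suc k) 0 + W< k t * ∑< p shifted
      ≡⟨ cong (λ m → W< k t * W (suc k) 0 + W< k t * m) (sym (trans (cong (∑< p shifted +_) (p<u⇒W≡0 (suc k) (n<1+n p))) (+-identityʳ _))) ⟩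
    W< k t * W (suc k) 0 + W< k t * ∑< (suc p) shifted   ≤⟨ +-mono-≤ (*-monoˡ-≤ (W (suc k) 0) (∑<-monoˡ-≤ (W k) (m≤n⇒m≤1+n t≤p)))
                                                                     (prefix-ratio-antitone shifted (W k) (m≤n⇒m≤1+n t≤p) (λ _ _ → W-diagonal k)) ⟩
    N k * W (suc k) 0 + ∑< t shifted * N k               ≡⟨ cong (_+ ∑< t shifted * N k) (*-comm (N k) (W (suc k) 0)) ⟩
    W (suc k) 0 * N k + ∑< t shifted * N k               ≡⟨ *-distribʳ-+ (N k) (W (suc k) 0) (∑< t shifted) ⟨
    (W (suc k) 0 + ∑< t shifted) * N k                   ≡⟨ cong (_* N k) (∑<-suc t (W (suc k))) ⟨
    W< (suc k) (suc t) * N k                             ∎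
    where
    open ≤-Reasoning
    shifted : ℕ → ℕ
    shifted u = W (suc k) (suc u)

  W-up : ∀ {k u} → Admissible k u → suc u * W (suc k) (suc u) ≡ (p ∸ u) * W k u
  W-up {k} {u} adm@(u≤k , dist≤ρ) = begin
    suc u * W (suc k) (suc u)                 ≡⟨ cong (suc u *_) (W-admissible adm′) ⟩
    suc u * ((p C suc u) * (q C (k ∸ u)))     ≡⟨ *-assoc (suc u) (p C suc u) (q C (k ∸ u)) ⟨
    suc u * (p C suc u) * (q C (k ∸ u))       ≡⟨ cong (_* (q C (k ∸ u))) ([k+1]*nC[k+1]≡[n-k]*nCk p u) ⟩
    (p ∸ u) * (p C u) * (q C (k ∸ u))         ≡⟨ *-assoc (p ∸ u) (p C u) (q C (k ∸ u)) ⟩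
    (p ∸ u) * ((p C u) * (q C (k ∸ u)))       ≡⟨ cong ((p ∸ u) *_) (W-admissible adm) ⟨
    (p ∸ u) * W k u                           ∎
    where
    open ≡-Reasoning
    adm′ : Admissible (suc k) (suc u)
    adm′ = s≤s u≤k , ≤-trans (+-monoˡ-≤ (k ∸ u) (∸-monoʳ-≤ p (n≤1+n u))) dist≤ρ

  W-side : ∀ {k u} → Admissible k u → Admissible (suc k) u →
           suc (k ∸ u) * W (suc k) u ≡ (q ∸ (k ∸ u)) * W k u
  W-side {k} {u} adm@(u≤k , _) adm′ = begin
    suc b * W (suc k) u                       ≡⟨ cong (suc b *_) (W-admissible adm′) ⟩
    suc b * ((p C u) * (q C (suc k ∸ u)))     ≡⟨ cong (λ m → suc b * ((p C u) * (q C m))) (+-∸-assoc 1 u≤k) ⟩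
    suc b * ((p C u) * (q C suc b))           ≡⟨ solve 3 (λ b′ x y → b′ :* (x :* y) := x :* (b′ :* y)) refl (suc b) (p C u) (q C suc b) ⟩
    (p C u) * (suc b * (q C suc b))           ≡⟨ cong ((p C u) *_) ([k+1]*nC[k+1]≡[n-k]*nCk q b) ⟩
    (p C u) * ((q ∸ b) * (q C b))             ≡⟨ solve 3 (λ x d y → x :* (d :* y) := d :* (x :* y)) refl (p C u) (q ∸ b) (q C b) ⟩
    (q ∸ b) * ((p C u) * (q C b))             ≡⟨ cong ((q ∸ b) *_) (W-admissible adm) ⟨
    (q ∸ b) * W k u                           ∎
    where
    open ≡-Reasoning
    b = k ∸ u

module LevelFlow (p q ρ : ℕ) where
  open import Data.Nat as ℕ using (zero; suc; _∸_; z≤n; s≤s; pred)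
  import Data.Nat.Properties as ℕ
  open import Data.Rational using (ℚ; 0ℚ; 1ℚ; _+_; _*_; _-_; _≤_)
  open import Data.Rational.Properties
  open import Data.Rational.Solver using (module +-*-Solver)
  open import Relation.Binary.PropositionalEquality
  open import Relation.Nullary using (does; yes; no)
  open import Data.Product using (_,_; proj₁)
  open import Function using (_∘_)
  open import Defs using (inv)
  open RationalArithmetic
  open LayerProfile p q ρ
  open +-*-Solver

  share : ℕ → ℕ → ℚ
  share k t = fromℕ (W< k t) * inv (N k)

  -- The mass of type u at level k splits into up k u, moving to type u + 1, and
  -- side k u, staying at type u: the monotone coupling of the type distributions of
  -- levels k and k + 1.
  up side : ℕ → ℕ → ℚ
  up k u   = share k (suc u) - share (suc k) (suc u)
  side k u = share (suc k) (suc u) - share k u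

  share[0] : ∀ {k} → share k 0 ≡ 0ℚ
  share[0] {k} = trans (cong (_* inv (N k)) fromℕ-0) (*-zeroˡ (inv (N k)))

  share-step : ∀ k t → share k (suc t) - share k t ≡ fromℕ (W k t) * inv (N k)
  share-step k t = begin
    fromℕ (W< k t ℕ.+ W k t) * inv (N k) - share k t
      ≡⟨ cong (λ x → x * inv (N k) - share k t) (fromℕ-+ (W< k t) (W k t)) ⟩
    (fromℕ (W< k t) + fromℕ (W k t)) * inv (N k) - fromℕ (W< k t) * inv (N k)
      ≡⟨ solve 3 (λ a b i → (a :+ b) :* i :- a :* i := b :* i) refl (fromℕ (W< k t)) (fromℕ (W k t)) (inv (N k)) ⟩
    fromℕ (W k t) * inv (N k) ∎
    where open ≡-Reasoning

  up+side : ∀ k u → up k u + side k u ≡ fromℕ (W k u) * inv (N k)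
  up+side k u = trans (solve 3 (λ a b c → (a :- b) :+ (b :- c) := a :- c) refl (share k (suc u)) (share (suc k) (suc u)) (share k u))
                      (share-step k u)

  up+side[1+u] : ∀ k u → up k u + side k (suc u) ≡ fromℕ (W (suc k) (suc u)) * inv (N (suc k))
  up+side[1+u] k u = trans (solve 3 (λ a b c → (a :- b) :+ (c :- a) := c :- b) refl
                                   (share k (suc u)) (share (suc k) (suc u)) (share (suc k) (suc (suc u))))
                           (share-step (suc k) (suc u))

  side[0] : ∀ k → side k 0 ≡ fromℕ (W (suc k) 0) * inv (N (suc k))
  side[0] k = trans (cong (share (suc k) 1 -_) (trans share[0] (sym share[0])))
                    (share-step (suc k) 0)

  module _ {k} (0<Nₖ : 0 ℕ.< N k) (0<Nₖ₊₁ : 0 ℕ.< N (suc k)) where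

    share-level : ∀ {t} → t ℕ.≤ suc p → share (suc k) t ≤ share k t
    share-level {t} t≤ = fromℕ*inv-mono (W< (suc k) t) (W< k t) 0<Nₖ 0<Nₖ₊₁ (W<-level k t≤)

    share-diagonal : ∀ {t} → t ℕ.≤ p → share k t ≤ share (suc k) (suc t)
    share-diagonal {t} t≤ = fromℕ*inv-mono (W< k t) (W< (suc k) (suc t)) 0<Nₖ₊₁ 0<Nₖ (W<-diagonal k t≤)

    up-nonNeg : ∀ {u} → u ℕ.≤ p → 0ℚ ≤ up k u
    up-nonNeg u≤p = p≤q⇒0≤q-p (share-level (s≤s u≤p))

    side-nonNeg : ∀ {u} → u ℕ.≤ p → 0ℚ ≤ side k u
    side-nonNeg u≤p = p≤q⇒0≤q-p (share-diagonal u≤p)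

    private
      up+side≡0 : ∀ {u} → W k u ≡ 0 → up k u + side k u ≡ 0ℚ
      up+side≡0 {u} W≡0 = trans (up+side k u) (trans (cong (λ w → fromℕ w * inv (N k)) W≡0) share[0])

    W≡0⇒up≡0 : ∀ {u} → u ℕ.≤ p → W k u ≡ 0 → up k u ≡ 0ℚ
    W≡0⇒up≡0 {u} u≤p W≡0 = x+y≡0⇒x≡0 {up k u} {side k u} (up-nonNeg u≤p) (side-nonNeg u≤p) (up+side≡0 {u} W≡0)

    W≡0⇒side≡0 : ∀ {u} → u ℕ.≤ p → W k u ≡ 0 → side k u ≡ 0ℚ
    W≡0⇒side≡0 {u} u≤p W≡0 = x+y≡0⇒x≡0 {side k u} {up k u} (side-nonNeg u≤p) (up-nonNeg u≤p)
                                         (trans (+-comm (side k u) (up k u)) (up+side≡0 {u} W≡0))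

  upInto : ℕ → ℕ → ℚ
  upInto k zero    = 0ℚ
  upInto k (suc u) = up k u

  upInto+side : ∀ k u → upInto k u + side k u ≡ fromℕ (W (suc k) u) * inv (N (suc k))
  upInto+side k zero    = trans (+-identityˡ (side k 0)) (side[0] k)
  upInto+side k (suc u) = up+side[1+u] k u

  -- Flow along a single covering pair: the mass of the move divided by the number of
  -- covering pairs realising it, counted from the upper level (inv 0 = 0 makes it
  -- vanish when there are none).
  upFlow sideFlow : ℕ → ℕ → ℚ
  upFlow k u   = up k u * inv (suc u ℕ.* W (suc k) (suc u))
  sideFlow k u = side k u * inv (suc (k ∸ u) ℕ.* W (suc k) u)

  private
    inv[m*0]≡0 : ∀ m → inv (m ℕ.* 0) ≡ 0ℚ
    inv[m*0]≡0 m rewrite ℕ.*-zeroʳ m = refl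

  N≡0⇒upFlow≡0 : ∀ {k} → N (suc k) ≡ 0 → ∀ u → upFlow k u ≡ 0ℚ
  N≡0⇒upFlow≡0 {k} N≡0 u = trans (cong (λ w → up k u * inv (suc u ℕ.* w)) (N≡0⇒W≡0 N≡0 (suc u)))
                                 (trans (cong (up k u *_) (inv[m*0]≡0 (suc u))) (*-zeroʳ (up k u)))

  N≡0⇒sideFlow≡0 : ∀ {k} → N (suc k) ≡ 0 → ∀ u → sideFlow k u ≡ 0ℚ
  N≡0⇒sideFlow≡0 {k} N≡0 u = trans (cong (λ w → side k u * inv (suc (k ∸ u) ℕ.* w)) (N≡0⇒W≡0 N≡0 u))
                                   (trans (cong (side k u *_) (inv[m*0]≡0 (suc (k ∸ u)))) (*-zeroʳ (side k u)))

  module _ {k} (0<Nₖ : 0 ℕ.< N k) (0<Nₖ₊₁ : 0 ℕ.< N (suc k)) where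

    upFlow-nonNeg : ∀ {u} → u ℕ.≤ p → 0ℚ ≤ upFlow k u
    upFlow-nonNeg {u} u≤p = *-nonNeg (up-nonNeg 0<Nₖ 0<Nₖ₊₁ u≤p) (inv-nonNeg (suc u ℕ.* W (suc k) (suc u)))

    sideFlow-nonNeg : ∀ {u} → u ℕ.≤ p → 0ℚ ≤ sideFlow k u
    sideFlow-nonNeg {u} u≤p = *-nonNeg (side-nonNeg 0<Nₖ 0<Nₖ₊₁ u≤p) (inv-nonNeg (suc (k ∸ u) ℕ.* W (suc k) u))

    upFlow-departure≤ : ∀ {u} → Admissible k u → u ℕ.≤ p → fromℕ (p ∸ u) * upFlow k u ≤ up k u * inv (W k u)
    upFlow-departure≤ {u} adm u≤p = subst (λ m → fromℕ (p ∸ u) * (up k u * inv m) ≤ up k u * inv (W k u)) (sym (W-up adm))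
                                          (fromℕ*[x*inv[*]]≤x*inv (p ∸ u) (W k u) (up-nonNeg 0<Nₖ 0<Nₖ₊₁ u≤p))

    sideFlow-departure≤ : ∀ {u} → Admissible k u → u ℕ.≤ p →
                          fromℕ (q ∸ (k ∸ u)) * (𝟙 (does (admissible? (suc k) u)) * sideFlow k u) ≤ side k u * inv (W k u)
    sideFlow-departure≤ {u} adm u≤p with admissible? (suc k) u
    ... | no _ = subst (_≤ side k u * inv (W k u))
                       (sym (trans (cong (fromℕ (q ∸ (k ∸ u)) *_) (*-zeroˡ (sideFlow k u))) (*-zeroʳ (fromℕ (q ∸ (k ∸ u))))))
                       (*-nonNeg (side-nonNeg 0<Nₖ 0<Nₖ₊₁ u≤p) (inv-nonNeg (W k u)))
    ... | yes adm′ = subst (λ m → fromℕ (q ∸ (k ∸ u)) * (1ℚ * (side k u * inv m)) ≤ side k u * inv (W k u)) (sym (W-side adm adm′))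
                           (subst (_≤ side k u * inv (W k u)) (cong (fromℕ (q ∸ (k ∸ u)) *_) (sym (*-identityˡ _)))
                                  (fromℕ*[x*inv[*]]≤x*inv (q ∸ (k ∸ u)) (W k u) (side-nonNeg 0<Nₖ 0<Nₖ₊₁ u≤p)))

    upFlow-arrival≡ : ∀ u → u ℕ.≤ p →
                      fromℕ u * (𝟙 (does (admissible? k (pred u))) * upFlow k (pred u)) ≡ upInto k u * inv (W (suc k) u)
    upFlow-arrival≡ zero    _   = trans (cong (_* X) fromℕ-0) (trans (*-zeroˡ X) (sym (*-zeroˡ (inv (W (suc k) 0)))))
      where X = 𝟙 (does (admissible? k 0)) * upFlow k 0
    upFlow-arrival≡ (suc u) u<p with admissible? k u
    ... | yes _    = trans (cong (fromℕ (suc u) *_) (*-identityˡ (upFlow k u)))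
                           (fromℕ*[x*inv[*]]≡x*inv (W (suc k) (suc u)) (up k u) (s≤s z≤n))
    ... | no  ¬adm = begin
      fromℕ (suc u) * (0ℚ * upFlow k u)     ≡⟨ cong (fromℕ (suc u) *_) (*-zeroˡ (upFlow k u)) ⟩
      fromℕ (suc u) * 0ℚ                    ≡⟨ *-zeroʳ (fromℕ (suc u)) ⟩
      0ℚ                                    ≡⟨ *-zeroˡ (inv (W (suc k) (suc u))) ⟨
      0ℚ * inv (W (suc k) (suc u))          ≡⟨ cong (_* inv (W (suc k) (suc u))) (W≡0⇒up≡0 0<Nₖ 0<Nₖ₊₁ (ℕ.<⇒≤ u<p) (W-inadmissible ¬adm)) ⟨
      up k u * inv (W (suc k) (suc u))      ∎
      where open ≡-Reasoning

    sideFlow-arrival≡ : ∀ {u} → u ℕ.≤ p → fromℕ (suc k ∸ u) * sideFlow k u ≡ side k u * inv (W (suc k) u)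
    sideFlow-arrival≡ {u} u≤p with u ℕ.≤? k
    ... | yes u≤k = trans (cong (λ b → fromℕ b * sideFlow k u) (ℕ.+-∸-assoc 1 u≤k))
                          (fromℕ*[x*inv[*]]≡x*inv (W (suc k) u) (side k u) (s≤s z≤n))
    ... | no  u≰k = begin
      fromℕ (suc k ∸ u) * sideFlow k u      ≡⟨ cong (λ b → fromℕ b * sideFlow k u) (ℕ.m≤n⇒m∸n≡0 (ℕ.≰⇒> u≰k)) ⟩
      fromℕ 0 * sideFlow k u                ≡⟨ cong (_* sideFlow k u) fromℕ-0 ⟩
      0ℚ * sideFlow k u                     ≡⟨ *-zeroˡ (sideFlow k u) ⟩
      0ℚ                                    ≡⟨ *-zeroˡ (inv (W (suc k) u)) ⟨
      0ℚ * inv (W (suc k) u)                ≡⟨ cong (_* inv (W (suc k) u)) (W≡0⇒side≡0 0<Nₖ 0<Nₖ₊₁ u≤p (W-inadmissible (u≰k ∘ proj₁))) ⟨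
      side k u * inv (W (suc k) u)          ∎
      where open ≡-Reasoning

  private
    [fromℕ*inv]*inv≡inv : ∀ {w} n → 0 ℕ.< w → fromℕ w * inv n * inv w ≡ inv n
    [fromℕ*inv]*inv≡inv {w} n 0<w = [fromℕ*x]*inv≡x (inv n) 0<w

  outflow≤inv[N] : ∀ {k u} → Admissible k u → u ℕ.≤ p → k ∸ u ℕ.≤ q →
                   fromℕ (p ∸ u) * upFlow k u + fromℕ (q ∸ (k ∸ u)) * (𝟙 (does (admissible? (suc k) u)) * sideFlow k u) ≤ inv (N k)
  outflow≤inv[N] {k} {u} adm u≤p b≤q with N (suc k) ℕ.≟ 0
  ... | yes N′≡0 = begin
    fromℕ (p ∸ u) * upFlow k u + fromℕ (q ∸ (k ∸ u)) * (𝟙 (does (admissible? (suc k) u)) * sideFlow k u)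
      ≡⟨ cong₂ (λ x y → fromℕ (p ∸ u) * x + fromℕ (q ∸ (k ∸ u)) * (𝟙 (does (admissible? (suc k) u)) * y))
               (N≡0⇒upFlow≡0 N′≡0 u) (N≡0⇒sideFlow≡0 N′≡0 u) ⟩
    fromℕ (p ∸ u) * 0ℚ + fromℕ (q ∸ (k ∸ u)) * (𝟙 (does (admissible? (suc k) u)) * 0ℚ)
      ≡⟨ solve 3 (λ a b c → a :* con 0ℚ :+ b :* (c :* con 0ℚ) := con 0ℚ) refl
                 (fromℕ (p ∸ u)) (fromℕ (q ∸ (k ∸ u))) (𝟙 (does (admissible? (suc k) u))) ⟩
    0ℚ                                                 ≤⟨ inv-nonNeg (N k) ⟩
    inv (N k)                                          ∎
    where open ≤-Reasoning
  ... | no N′≢0 = begin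
    fromℕ (p ∸ u) * upFlow k u + fromℕ (q ∸ (k ∸ u)) * (𝟙 (does (admissible? (suc k) u)) * sideFlow k u)
      ≤⟨ +-mono-≤ (upFlow-departure≤ 0<Nₖ 0<Nₖ₊₁ adm u≤p) (sideFlow-departure≤ 0<Nₖ 0<Nₖ₊₁ adm u≤p) ⟩
    up k u * inv (W k u) + side k u * inv (W k u)      ≡⟨ *-distribʳ-+ (inv (W k u)) (up k u) (side k u) ⟨
    (up k u + side k u) * inv (W k u)                  ≡⟨ cong (_* inv (W k u)) (up+side k u) ⟩
    fromℕ (W k u) * inv (N k) * inv (W k u)            ≡⟨ [fromℕ*inv]*inv≡inv (N k) (0<W adm u≤p b≤q) ⟩
    inv (N k)                                          ∎
    where
    open ≤-Reasoning
    0<Nₖ   = 0<N adm u≤p b≤q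
    0<Nₖ₊₁ = ℕ.n≢0⇒n>0 N′≢0

  inflow≡inv[N] : ∀ {k u} → Admissible (suc k) u → u ℕ.≤ p → suc k ∸ u ℕ.≤ q → p ∸ ρ ℕ.≤ k →
                  fromℕ u * (𝟙 (does (admissible? k (pred u))) * upFlow k (pred u)) + fromℕ (suc k ∸ u) * sideFlow k u ≡ inv (N (suc k))
  inflow≡inv[N] {k} {u} adm u≤p b≤q p∸ρ≤k = begin
    fromℕ u * (𝟙 (does (admissible? k (pred u))) * upFlow k (pred u)) + fromℕ (suc k ∸ u) * sideFlow k u
      ≡⟨ cong₂ _+_ (upFlow-arrival≡ 0<Nₖ 0<Nₖ₊₁ u u≤p) (sideFlow-arrival≡ 0<Nₖ 0<Nₖ₊₁ u≤p) ⟩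
    upInto k u * inv (W (suc k) u) + side k u * inv (W (suc k) u)  ≡⟨ *-distribʳ-+ (inv (W (suc k) u)) (upInto k u) (side k u) ⟨
    (upInto k u + side k u) * inv (W (suc k) u)                     ≡⟨ cong (_* inv (W (suc k) u)) (upInto+side k u) ⟩
    fromℕ (W (suc k) u) * inv (N (suc k)) * inv (W (suc k) u)       ≡⟨ [fromℕ*inv]*inv≡inv (N (suc k)) (0<W adm u≤p b≤q) ⟩
    inv (N (suc k))                                                 ∎
    where
    open ≡-Reasoning
    0<Nₖ   = 0<N-below adm u≤p b≤q p∸ρ≤k
    0<Nₖ₊₁ = 0<N adm u≤p b≤q

module Rank {n : ℕ} (P : List (Subset n)) (h : Subset n → ℕ)
  (h-mono : ∀ {x y} → x ∈ P → y ∈ P → y ⊂ x → h y < h x)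
  (h-pred : ∀ {x} → x ∈ P → 0 < h x → ∃ λ y → y ∈ P × y ⊂ x × h x ≡ suc (h y)) where

  open import Data.Nat
  open import Data.Nat.Properties
  open import Data.List using ([]; _∷_; map; filter; length)
  open import Data.List.Properties using (length-filter; foldr-preservesᵇ; foldr-preservesᵒ)
  open import Data.List.Relation.Unary.All as All using ()
  import Data.List.Relation.Unary.All.Properties as All
  import Data.List.Relation.Unary.Any.Properties as Any
  open import Data.List.Relation.Unary.Any using (here; there)
  open import Data.List.Membership.Propositional using (lose)
  open import Data.List.Membership.Propositional.Properties using (∈-filter⁺; ∈-filter⁻)
  open import Data.Fin.Subset.Properties using (_⊂?_; ⊂-trans; ⊂-irref)
  open import Data.Product using (_,_)
  open import Data.Sum using ([_,_]; inj₂)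
  open import Relation.Nullary using (yes; no; contradiction)
  open import Relation.Binary.PropositionalEquality hiding ([_])
  open import Defs using (rank; rankFuel; maxList)

  below : List (Subset n) → Subset n → List (Subset n)
  below xs x = filter (_⊂? x) xs

  rankFuel≡ : ∀ k {x} → x ∈ P → rankFuel k P x ≡ k ⊓ h x
  rankFuel≡ zero    _       = refl
  rankFuel≡ (suc k) {x} x∈P = ≤-antisym upper (lower (h x) refl)
    where
    1+rank : Subset n → ℕ
    1+rank y = suc (rankFuel k P y)

    upper : maxList (map 1+rank (below P x)) ≤ suc k ⊓ h x
    upper = foldr-preservesᵇ {P = _≤ suc k ⊓ h x} ⊔-lub z≤n (All.map⁺ (All.tabulate bound))
      where
      bound : ∀ {y} → y ∈ below P x → 1+rank y ≤ suc k ⊓ h x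
      bound {y} y∈below with ∈-filter⁻ (_⊂? x) {xs = P} y∈below
      ... | y∈P , y⊂x = subst (_≤ suc k ⊓ h x) (cong suc (sym (rankFuel≡ k y∈P)))
                              (⊓-monoʳ-≤ (suc k) (h-mono x∈P y∈P y⊂x))

    lower : ∀ j → h x ≡ j → suc k ⊓ h x ≤ maxList (map 1+rank (below P x))
    lower zero    hx≡0 rewrite hx≡0 = z≤n
    lower (suc j) hx≡1+j with h-pred x∈P (subst (0 <_) (sym hx≡1+j) (s≤s z≤n))
    ... | y , y∈P , y⊂x , hx≡1+hy =
      foldr-preservesᵒ {P = suc k ⊓ h x ≤_} (λ a b → [ (λ le → ≤-trans le (m≤m⊔n a b)) , (λ le → ≤-trans le (m≤n⊔m a b)) ]) 0 _
        (inj₂ (Any.map⁺ (lose (∈-filter⁺ (_⊂? x) y∈P y⊂x)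
          (≤-reflexive (sym (trans (cong suc (rankFuel≡ k y∈P)) (cong (λ m → suc k ⊓ m) (sym hx≡1+hy))))))))

  private
    #below-mono : ∀ xs {x y} → y ⊂ x → length (below xs y) ≤ length (below xs x)
    #below-mono []       y⊂x = z≤n
    #below-mono (z ∷ xs) {x} {y} y⊂x with z ⊂? y | z ⊂? x
    ... | yes z⊂y | yes _   = s≤s (#below-mono xs y⊂x)
    ... | yes z⊂y | no z⊄x  = contradiction (⊂-trans z⊂y y⊂x) z⊄x
    ... | no  _   | yes _   = m≤n⇒m≤1+n (#below-mono xs y⊂x)
    ... | no  _   | no  _   = #below-mono xs y⊂x

    #below-strict : ∀ xs {x y} → y ∈ xs → y ⊂ x → length (below xs y) < length (below xs x)
    #below-strict (z ∷ xs) {x} {y} (here refl) y⊂x with z ⊂? y | z ⊂? x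
    ... | yes z⊂z | _      = contradiction z⊂z (⊂-irref refl)
    ... | no  _   | yes _  = s≤s (#below-mono xs y⊂x)
    ... | no  _   | no z⊄x = contradiction y⊂x z⊄x
    #below-strict (z ∷ xs) {x} {y} (there y∈xs) y⊂x with z ⊂? y | z ⊂? x
    ... | yes z⊂y | yes _  = s≤s (#below-strict xs y∈xs y⊂x)
    ... | yes z⊂y | no z⊄x = contradiction (⊂-trans z⊂y y⊂x) z⊄x
    ... | no  _   | yes _  = m<n⇒m<1+n (#below-strict xs y∈xs y⊂x)
    ... | no  _   | no  _  = #below-strict xs y∈xs y⊂x

    h≤#below : ∀ j {x} → x ∈ P → h x ≡ j → j ≤ length (below P x)
    h≤#below zero    _   _ = z≤n
    h≤#below (suc j) x∈P hx≡1+j with h-pred x∈P (subst (0 <_) (sym hx≡1+j) (s≤s z≤n))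
    ... | y , y∈P , y⊂x , hx≡1+hy =
      ≤-trans (s≤s (h≤#below j y∈P (suc-injective (trans (sym hx≡1+hy) hx≡1+j)))) (#below-strict P y∈P y⊂x)

  rank≡h : ∀ {x} → x ∈ P → rank P x ≡ h x
  rank≡h {x} x∈P = trans (rankFuel≡ (length P) x∈P)
    (m≥n⇒m⊓n≡n (≤-trans (h≤#below (h x) x∈P refl) (length-filter (_⊂? x) P)))

module HammingBall {n : ℕ} (c : Subset n) (ρ : ℕ) where
  open import Data.Nat
  open import Data.Nat.Properties
  open import Data.Nat.Combinatorics using (_C_)
  open import Data.Bool using (true; false; if_then_else_)
  open import Data.List using (List; []; _∷_; filter; length)
  open import Data.List.Membership.Propositional using (_∈_)
  open import Data.List.Membership.Propositional.Properties using (∈-filter⁺; ∈-filter⁻)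
  open import Data.Fin.Subset using (_⊂_; ∣_∣)
  open import Data.Fin.Subset.Properties using (p⊂q⇒∣p∣<∣q∣)
  open import Data.Product using (_×_; _,_; ∃; proj₂)
  open import Function using (_∘_; _⇔_; mk⇔; Equivalence)
  open import Relation.Nullary using (yes; no; does; contradiction)
  open import Relation.Nullary.Decidable using (dec-true; dec-false; does-⇔)
  open import Relation.Unary using (Pred; Decidable)
  open import Relation.Binary.PropositionalEquality
  open import Algebra.Properties.CommutativeSemigroup *-commutativeSemigroup using (x∙yz≈y∙xz)
  open import Defs using (allSubsets; hammingDist; rank; layerSize)
  open CubeCounting
  open FiniteSums +-*-commutativeSemiring using (∑; ∑-cong; ∑-*ˡ; ∑-filter; ∑<; ∑<-cong; ∑<-0; ∑<-∑-swap)

  p q : ℕ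
  p = sideSize true c
  q = sideSize false c

  open LayerProfile p q ρ

  P : List (Subset n)
  P = filter (λ x → hammingDist x c ≤? ρ) (allSubsets n)

  U B size height : Subset n → ℕ
  U x      = count true c x
  B x      = count false c x
  size x   = U x + B x
  height x = size x ∸ (p ∸ ρ)

  count≤sideSize : ∀ s x → count s c x ≤ sideSize s c
  count≤sideSize s x = subst (count s c x ≤_) (count+missing s c x) (m≤m+n _ _)

  missing≡ : ∀ s x → missing s c x ≡ sideSize s c ∸ count s c x
  missing≡ s x = sym (trans (cong (_∸ count s c x) (sym (count+missing s c x))) (m+n∸m≡n (count s c x) (missing s c x)))

  hammingDist≡ : ∀ x → hammingDist x c ≡ p ∸ U x + B x
  hammingDist≡ x = trans (hammingDist≡missing+count c x) (cong (_+ B x) (missing≡ true x))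

  B≡size∸U : ∀ x → B x ≡ size x ∸ U x
  B≡size∸U x = sym (m+n∸m≡n (U x) (B x))

  inBall⇔admissible : ∀ x → hammingDist x c ≤ ρ ⇔ Admissible (size x) (U x)
  inBall⇔admissible x = mk⇔
    (λ d≤ρ → admissible-type (subst (_≤ ρ) (hammingDist≡ x) d≤ρ))
    (λ (_ , d≤ρ) → subst (_≤ ρ) (sym (hammingDist≡ x)) (subst (λ b → p ∸ U x + b ≤ ρ) (sym (B≡size∸U x)) d≤ρ))

  ∈P⇔inBall : ∀ x → x ∈ P ⇔ hammingDist x c ≤ ρ
  ∈P⇔inBall x = mk⇔ (proj₂ ∘ ∈-filter⁻ (λ x → hammingDist x c ≤? ρ) {xs = allSubsets n})
                    (∈-filter⁺ (λ x → hammingDist x c ≤? ρ) (∈-allSubsets x))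

  ∈P⇒admissible : ∀ {x} → x ∈ P → Admissible (size x) (U x)
  ∈P⇒admissible {x} = Equivalence.to (inBall⇔admissible x) ∘ Equivalence.to (∈P⇔inBall x)

  inBall≡admissible : ∀ x → does (hammingDist x c ≤? ρ) ≡ does (admissible? (size x) (U x))
  inBall≡admissible x = does-⇔ (inBall⇔admissible x) (hammingDist x c ≤? ρ) (admissible? (size x) (U x))

  p∸ρ≤size : ∀ {x} → x ∈ P → p ∸ ρ ≤ size x
  p∸ρ≤size = admissible⇒p∸ρ≤k ∘ ∈P⇒admissible

  size≡∣∣ : ∀ x → size x ≡ ∣ x ∣
  size≡∣∣ x = sym (∣x∣≡count+count c x)

  step⇒size : ∀ s {x y} → step s c x y ≡ true → size y ≡ suc (size x)
  step⇒size true  {x} {y} x→y = let (U↑ , B=) = step⇒count true c x y x→y in cong₂ _+_ U↑ B=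
  step⇒size false {x} {y} x→y = let (B↑ , U=) = step⇒count false c x y x→y in trans (cong₂ _+_ U= B↑) (+-suc (U x) (B x))

  height-suc : ∀ {x y} → x ∈ P → size y ≡ suc (size x) → height y ≡ suc (height x)
  height-suc x∈P size≡ = trans (cong (_∸ (p ∸ ρ)) size≡) (+-∸-assoc 1 (p∸ρ≤size x∈P))

  0<N[size] : ∀ {x} → x ∈ P → 0 < N (size x)
  0<N[size] {x} x∈P = 0<N (∈P⇒admissible x∈P) (count≤sideSize true x) (subst (_≤ q) (B≡size∸U x) (count≤sideSize false x))

  inside-step-∈P : ∀ {x y} → step true c x y ≡ true → x ∈ P → y ∈ P
  inside-step-∈P {x} {y} x→y x∈P = let (U↑ , B=) = step⇒count true c x y x→y in
    Equivalence.from (∈P⇔inBall y) (subst (_≤ ρ) (sym (hammingDist≡ y)) (≤-trans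
      (subst₂ (λ u b → p ∸ u + b ≤ p ∸ U x + B x) (sym U↑) (sym B=) (+-monoˡ-≤ (B x) (∸-monoʳ-≤ p (n≤1+n (U x)))))
      (subst (_≤ ρ) (hammingDist≡ x) (Equivalence.to (∈P⇔inBall x) x∈P))))

  outside-step-∈P : ∀ {x y} → step false c x y ≡ true → y ∈ P → x ∈ P
  outside-step-∈P {x} {y} x→y y∈P = let (B↑ , U=) = step⇒count false c x y x→y in
    Equivalence.from (∈P⇔inBall x) (subst (_≤ ρ) (sym (hammingDist≡ x)) (≤-trans
      (subst₂ (λ u b → p ∸ U x + B x ≤ p ∸ u + b) (sym U=) (sym B↑) (+-monoʳ-≤ (p ∸ U x) (n≤1+n (B x))))
      (subst (_≤ ρ) (hammingDist≡ y) (Equivalence.to (∈P⇔inBall y) y∈P))))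

  height-mono : ∀ {x y} → x ∈ P → y ∈ P → y ⊂ x → height y < height x
  height-mono {x} {y} _ y∈P y⊂x = ∸-monoˡ-< (subst₂ _<_ (sym (size≡∣∣ y)) (sym (size≡∣∣ x)) (p⊂q⇒∣p∣<∣q∣ y⊂x)) (p∸ρ≤size y∈P)

  private
    down : ∀ s {x y} → step s c y x ≡ true → y ∈ P → ∃ λ y → y ∈ P × y ⊂ x × height x ≡ suc (height y)
    down s {x} {y} y→x y∈P = y , y∈P , step⇒⊂ s c y x y→x , height-suc y∈P (step⇒size s y→x)

  height-pred : ∀ {x} → x ∈ P → 0 < height x → ∃ λ y → y ∈ P × y ⊂ x × height x ≡ suc (height y)
  height-pred {x} x∈P 0<h with 0 <? B x
  ... | yes 0<B = let (y , y→x) = lowerStep false c x 0<B in down false y→x (outside-step-∈P y→x x∈P)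
  ... | no 0≮B = let (y , y→x) = lowerStep true c x (≤-trans (s≤s z≤n) p∸ρ<U) in down true y→x (y∈P y→x)
    where
    B≡ : B x ≡ 0
    B≡ = n≤0⇒n≡0 (≮⇒≥ 0≮B)
    p∸ρ<U : p ∸ ρ < U x
    p∸ρ<U = subst (p ∸ ρ <_) (trans (cong (U x +_) B≡) (+-identityʳ (U x))) (m∸n≢0⇒n<m (<⇒≢ 0<h ∘ sym))
    y∈P : ∀ {y} → step true c y x ≡ true → y ∈ P
    y∈P {y} y→x = let (U↑ , B=) = step⇒count true c y x y→x in
      Equivalence.from (∈P⇔inBall y) (subst (_≤ ρ) (sym (hammingDist≡ y))
        (subst (λ b → p ∸ U y + b ≤ ρ) (sym (trans (sym B=) B≡)) (subst (_≤ ρ) (sym (+-identityʳ (p ∸ U y)))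
          (m∸n≤o⇒m∸o≤n (≤-pred (subst (p ∸ ρ <_) U↑ p∸ρ<U))))))

  open Rank P height height-mono height-pred public using (rank≡h)

  private
    length-filter≡∑ : ∀ {a ℓ} {A : Set a} {Q : Pred A ℓ} (Q? : Decidable Q) xs →
                      length (filter Q? xs) ≡ ∑[ x ← xs ] 𝟙ℕ (does (Q? x))
    length-filter≡∑ Q? []       = refl
    length-filter≡∑ Q? (x ∷ xs) with does (Q? x)
    ... | true  = cong suc (length-filter≡∑ Q? xs)
    ... | false = length-filter≡∑ Q? xs

    select : ∀ t {a} (g : ℕ → ℕ) → a < t → ∑[ u < t ] (𝟙ℕ (a ≡ᵇ u) * g u) ≡ g a
    select (suc t) {a} g a<1+t with a ≟ t
    ... | yes refl = begin
      ∑[ u < t ] (𝟙ℕ (a ≡ᵇ u) * g u) + 𝟙ℕ (a ≡ᵇ a) * g a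
        ≡⟨ cong₂ _+_ (trans (∑<-cong t (λ u u<a → cong (λ b → 𝟙ℕ b * g u) (dec-false (a ≟ u) (>⇒≢ u<a)))) (∑<-0 t))
                                                                          (cong (λ b → 𝟙ℕ b * g a) (dec-true (a ≟ a) refl)) ⟩
      0 + 1 * g a                                           ≡⟨ +-identityʳ (g a) ⟩
      g a                                                   ∎
      where open ≡-Reasoning
    ... | no a≢t = trans (cong₂ _+_ (select t g (≤∧≢⇒< (≤-pred a<1+t) a≢t)) (cong (λ b → 𝟙ℕ b * g t) (dec-false (a ≟ t) a≢t)))
                         (+-identityʳ (g a))

    W≡𝟙*C*C : ∀ k u → W k u ≡ 𝟙ℕ (does (admissible? k u)) * ((p C u) * (q C (k ∸ u)))
    W≡𝟙*C*C k u with admissible? k u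
    ... | yes adm  = trans (W-admissible adm) (sym (+-identityʳ _))
    ... | no  ¬adm = W-inadmissible ¬adm

    if-same : ∀ b → (if b then 0 else 0) ≡ 0
    if-same true  = refl
    if-same false = refl

  inLevel : ℕ → Subset n → ℕ
  inLevel k y = if does (hammingDist y c ≤? ρ) then 𝟙ℕ (size y ≡ᵇ k) else 0

  private

    inLevel≡ : ∀ k y → inLevel k y ≡ 𝟙ℕ (does (admissible? k (U y))) * 𝟙ℕ (B y ≡ᵇ k ∸ U y)
    inLevel≡ k y rewrite inBall≡admissible y with size y ≟ k
    ... | yes refl rewrite dec-true (size y ≟ size y) refl | dec-true (B y ≟ size y ∸ U y) (B≡size∸U y)
                   with does (admissible? (size y) (U y))
    ...   | true  = refl
    ...   | false = refl
    inLevel≡ k y | no size≢k rewrite dec-false (size y ≟ k) size≢k with admissible? k (U y)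
    ... | no _ = if-same (does (admissible? (size y) (U y)))
    ... | yes (U≤k , _) with B y ≟ k ∸ U y
    ...   | yes B≡ = contradiction (trans (cong (U y +_) B≡) (m+[n∸m]≡n U≤k)) size≢k
    ...   | no B≢ rewrite dec-false (B y ≟ k ∸ U y) B≢ = if-same (does (admissible? (size y) (U y)))

  levelCount : ∀ k → ∑[ y ← allSubsets n ] inLevel k y ≡ N k
  levelCount k = begin
    ∑[ y ← allSubsets n ] inLevel k y
      ≡⟨ ∑-cong (allSubsets n) (λ {y} _ → trans (inLevel≡ k y)
           (sym (select (suc p) (λ u → 𝟙ℕ (does (admissible? k u)) * 𝟙ℕ (B y ≡ᵇ k ∸ u)) (s≤s (count≤sideSize true y))))) ⟩
    ∑[ y ← allSubsets n ] ∑[ u < suc p ] (𝟙ℕ (U y ≡ᵇ u) * (𝟙ℕ (does (admissible? k u)) * 𝟙ℕ (B y ≡ᵇ k ∸ u)))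
      ≡⟨ ∑<-∑-swap (suc p) (allSubsets n) (λ u y → 𝟙ℕ (U y ≡ᵇ u) * (𝟙ℕ (does (admissible? k u)) * 𝟙ℕ (B y ≡ᵇ k ∸ u))) ⟨
    ∑[ u < suc p ] ∑[ y ← allSubsets n ] (𝟙ℕ (U y ≡ᵇ u) * (𝟙ℕ (does (admissible? k u)) * 𝟙ℕ (B y ≡ᵇ k ∸ u)))
      ≡⟨ ∑<-cong (suc p) (λ u _ → per-type u) ⟩
    N k ∎
    where
    open ≡-Reasoning
    per-type : ∀ u → ∑[ y ← allSubsets n ] (𝟙ℕ (U y ≡ᵇ u) * (𝟙ℕ (does (admissible? k u)) * 𝟙ℕ (B y ≡ᵇ k ∸ u))) ≡ W k u
    per-type u = begin
      ∑[ y ← allSubsets n ] (𝟙ℕ (U y ≡ᵇ u) * (𝟙ℕ (does (admissible? k u)) * 𝟙ℕ (B y ≡ᵇ k ∸ u)))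
        ≡⟨ ∑-cong (allSubsets n) (λ {y} _ → x∙yz≈y∙xz (𝟙ℕ (U y ≡ᵇ u)) (𝟙ℕ (does (admissible? k u))) (𝟙ℕ (B y ≡ᵇ k ∸ u))) ⟩
      ∑[ y ← allSubsets n ] (𝟙ℕ (does (admissible? k u)) * (𝟙ℕ (U y ≡ᵇ u) * 𝟙ℕ (B y ≡ᵇ k ∸ u)))
        ≡⟨ ∑-*ˡ (allSubsets n) (𝟙ℕ (does (admissible? k u))) (λ y → 𝟙ℕ (U y ≡ᵇ u) * 𝟙ℕ (B y ≡ᵇ k ∸ u)) ⟩
      𝟙ℕ (does (admissible? k u)) * ∑[ y ← allSubsets n ] (𝟙ℕ (U y ≡ᵇ u) * 𝟙ℕ (B y ≡ᵇ k ∸ u))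
        ≡⟨ cong (𝟙ℕ (does (admissible? k u)) *_) (#type≡C*C c u (k ∸ u)) ⟩
      𝟙ℕ (does (admissible? k u)) * ((p C u) * (q C (k ∸ u)))
        ≡⟨ W≡𝟙*C*C k u ⟨
      W k u ∎

  layerSize≡N : ∀ {x} → x ∈ P → layerSize P (rank P x) ≡ N (size x)
  layerSize≡N {x} x∈P = begin
    length (filter (λ y → rank P y ≟ rank P x) P)                ≡⟨ length-filter≡∑ (λ y → rank P y ≟ rank P x) P ⟩
    ∑[ y ← P ] 𝟙ℕ (does (rank P y ≟ rank P x))
      ≡⟨ ∑-cong P (λ {y} y∈P → cong 𝟙ℕ (does-⇔ (same-level y∈P) (rank P y ≟ rank P x) (size y ≟ size x))) ⟩
    ∑[ y ← P ] 𝟙ℕ (size y ≡ᵇ size x)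
      ≡⟨ ∑-filter (λ y → hammingDist y c ≤? ρ) (allSubsets n) (λ y → 𝟙ℕ (size y ≡ᵇ size x)) ⟩
    ∑[ y ← allSubsets n ] inLevel (size x) y                     ≡⟨ levelCount (size x) ⟩
    N (size x)                                                   ∎
    where
    open ≡-Reasoning
    same-level : ∀ {y} → y ∈ P → rank P y ≡ rank P x ⇔ size y ≡ size x
    same-level {y} y∈P = mk⇔
      (λ r≡ → trans (sym (m∸n+n≡m (p∸ρ≤size y∈P)))
                    (trans (cong (_+ (p ∸ ρ)) (trans (sym (rank≡h y∈P)) (trans r≡ (rank≡h x∈P)))) (m∸n+n≡m (p∸ρ≤size x∈P))))
      (λ s≡ → trans (rank≡h y∈P) (trans (cong (_∸ (p ∸ ρ)) s≡) (sym (rank≡h x∈P))))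

module HammingBallFlow {n : ℕ} (c : Subset n) (ρ : ℕ) where
  open import Data.Nat as ℕ using (suc; pred; _∸_; _≤?_; s≤s; z≤n)
  import Data.Nat.Properties as ℕ
  open import Data.Bool using (Bool; true; false; if_then_else_)
  open import Data.List using ([]; _∷_)
  open import Data.List.Membership.Propositional using (_∈_)
  open import Data.Fin.Subset using (_⊂_)
  open import Data.Product using (_×_; _,_; proj₁; proj₂)
  open import Data.Rational using (ℚ; 0ℚ; 1ℚ; _+_; _*_; _≤_)
  open import Data.Rational.Properties hiding (_≤?_)
  open import Data.Rational.Solver using (module +-*-Solver)
  open import Function using (_∘_; Equivalence)
  open import Relation.Nullary using (Dec; yes; no; does; ¬_; contradiction)
  open import Relation.Nullary.Decidable using (dec-true)
  open import Relation.Binary.PropositionalEquality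
  open import Defs using (allSubsets; hammingDist; rank; inv)
  open CubeCounting
  open HammingBall c ρ
  open LayerProfile p q ρ using (Admissible; admissible?; N)
  open LevelFlow p q ρ
  open RationalArithmetic
  open ∑ℚ using (∑; ∑-cong; ∑-+; ∑-*ˡ; ∑-0; ∑-filter)
  open FlowBound
  open +-*-Solver
  module ∑ℕ = FiniteSums ℕ.+-*-commutativeSemiring

  flow : Subset n → Subset n → ℚ
  flow x y = 𝟙 (step true c x y) * upFlow (size x) (U x) + 𝟙 (step false c x y) * sideFlow (size x) (U x)

  private
    if≡𝟙* : ∀ b x → (if b then x else 0ℚ) ≡ 𝟙 b * x
    if≡𝟙* true  x = sym (*-identityˡ x)
    if≡𝟙* false x = sym (*-zeroˡ x)

    fromℕ-𝟙ℕ : ∀ b → fromℕ (𝟙ℕ b) ≡ 𝟙 b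
    fromℕ-𝟙ℕ true  = fromℕ-1
    fromℕ-𝟙ℕ false = fromℕ-0

    𝟙*-steps : ∀ e s t (A B A′ B′ : ℚ) → (s ≡ true → t ≡ false × 𝟙 e * A ≡ A′) → (t ≡ true → 𝟙 e * B ≡ B′) →
               𝟙 e * (𝟙 s * A + 𝟙 t * B) ≡ 𝟙 s * A′ + 𝟙 t * B′
    𝟙*-steps e true t A B A′ B′ hs _ with hs refl
    ... | refl , eA = begin
      𝟙 e * (1ℚ * A + 0ℚ * B)    ≡⟨ solve 3 (λ e a b → e :* (con 1ℚ :* a :+ con 0ℚ :* b) := e :* a) refl (𝟙 e) A B ⟩
      𝟙 e * A                    ≡⟨ eA ⟩
      A′                         ≡⟨ solve 2 (λ a b → a := con 1ℚ :* a :+ con 0ℚ :* b) refl A′ B′ ⟩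
      1ℚ * A′ + 0ℚ * B′          ∎
      where open ≡-Reasoning
    𝟙*-steps e false true A B A′ B′ _ ht = begin
      𝟙 e * (0ℚ * A + 1ℚ * B)    ≡⟨ solve 3 (λ e a b → e :* (con 0ℚ :* a :+ con 1ℚ :* b) := e :* b) refl (𝟙 e) A B ⟩
      𝟙 e * B                    ≡⟨ ht refl ⟩
      B′                         ≡⟨ solve 2 (λ a b → b := con 0ℚ :* a :+ con 1ℚ :* b) refl A′ B′ ⟩
      0ℚ * A′ + 1ℚ * B′          ∎
      where open ≡-Reasoning
    𝟙*-steps e false false A B A′ B′ _ _ =
      solve 5 (λ e a b a′ b′ → e :* (con 0ℚ :* a :+ con 0ℚ :* b) := con 0ℚ :* a′ :+ con 0ℚ :* b′) refl (𝟙 e) A B A′ B′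

    ∑-𝟙* : ∀ (g : Subset n → Bool) (X : ℚ) ys → ∑[ y ← ys ] (𝟙 (g y) * X) ≡ fromℕ (∑ℕ.∑ ys (𝟙ℕ ∘ g)) * X
    ∑-𝟙* g X []       = sym (trans (cong (_* X) fromℕ-0) (*-zeroˡ X))
    ∑-𝟙* g X (y ∷ ys) = begin
      𝟙 (g y) * X + ∑[ z ← ys ] (𝟙 (g z) * X)         ≡⟨ cong₂ (λ a b → a * X + b) (sym (fromℕ-𝟙ℕ (g y))) (∑-𝟙* g X ys) ⟩
      fromℕ (𝟙ℕ (g y)) * X + fromℕ (∑ℕ.∑ ys (𝟙ℕ ∘ g)) * X ≡⟨ *-distribʳ-+ X (fromℕ (𝟙ℕ (g y))) (fromℕ (∑ℕ.∑ ys (𝟙ℕ ∘ g))) ⟨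
      (fromℕ (𝟙ℕ (g y)) + fromℕ (∑ℕ.∑ ys (𝟙ℕ ∘ g))) * X  ≡⟨ cong (_* X) (fromℕ-+ (𝟙ℕ (g y)) _) ⟨
      fromℕ (𝟙ℕ (g y) ℕ.+ ∑ℕ.∑ ys (𝟙ℕ ∘ g)) * X          ∎
      where open ≡-Reasoning

  flow-⊂ : ∀ {x y} → ¬ x ⊂ y → flow x y ≡ 0ℚ
  flow-⊂ {x} {y} x⊄y = vanish (step true c x y) (step false c x y) (x⊄y ∘ step⇒⊂ true c x y) (x⊄y ∘ step⇒⊂ false c x y)
    where
    vanish : ∀ s t → ¬ s ≡ true → ¬ t ≡ true → 𝟙 s * upFlow (size x) (U x) + 𝟙 t * sideFlow (size x) (U x) ≡ 0ℚ
    vanish true  _     s≢ _  = contradiction refl s≢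
    vanish false true  _  t≢ = contradiction refl t≢
    vanish false false _  _  = solve 2 (λ a b → con 0ℚ :* a :+ con 0ℚ :* b := con 0ℚ) refl (upFlow (size x) (U x)) (sideFlow (size x) (U x))

  flow-nonNeg : ∀ {x y} → x ∈ P → y ∈ P → 0ℚ ≤ flow x y
  flow-nonNeg {x} {y} x∈P y∈P = nonNeg (step true c x y) (step false c x y)
    (λ x→y → upFlow-nonNeg (0<N[size] x∈P) (0<N[1+size] true x→y) (count≤sideSize true x))
    (λ x→y → sideFlow-nonNeg (0<N[size] x∈P) (0<N[1+size] false x→y) (count≤sideSize true x))
    where
    0<N[1+size] : ∀ s → step s c x y ≡ true → 0 ℕ.< N (suc (size x))
    0<N[1+size] s x→y = subst (λ k → 0 ℕ.< N k) (step⇒size s x→y) (0<N[size] y∈P)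
    nonNeg : ∀ s t → (s ≡ true → 0ℚ ≤ upFlow (size x) (U x)) → (t ≡ true → 0ℚ ≤ sideFlow (size x) (U x)) →
             0ℚ ≤ 𝟙 s * upFlow (size x) (U x) + 𝟙 t * sideFlow (size x) (U x)
    nonNeg s t hs ht = +-mono-≤ (nonNeg′ s hs) (nonNeg′ t ht)
      where
      nonNeg′ : ∀ b {X} → (b ≡ true → 0ℚ ≤ X) → 0ℚ ≤ 𝟙 b * X
      nonNeg′ true  {X} h = subst (0ℚ ≤_) (sym (*-identityˡ X)) (h refl)
      nonNeg′ false {X} _ = ≤-reflexive (sym (*-zeroˡ X))

  private
    ∑P≡∑𝟙* : ∀ (f : Subset n → ℚ) → ∑ P f ≡ ∑[ y ← allSubsets n ] (𝟙 (does (hammingDist y c ≤? ρ)) * f y)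
    ∑P≡∑𝟙* f = trans (∑-filter (λ y → hammingDist y c ≤? ρ) (allSubsets n) f)
                     (∑-cong (allSubsets n) (λ {y} _ → if≡𝟙* (does (hammingDist y c ≤? ρ)) (f y)))

    ∑-steps : ∀ (g h : Subset n → Bool) A B →
              ∑[ y ← allSubsets n ] (𝟙 (g y) * A + 𝟙 (h y) * B) ≡
              fromℕ (∑ℕ.∑ (allSubsets n) (𝟙ℕ ∘ g)) * A + fromℕ (∑ℕ.∑ (allSubsets n) (𝟙ℕ ∘ h)) * B
    ∑-steps g h A B = trans (∑-+ (allSubsets n) (λ y → 𝟙 (g y) * A) (λ y → 𝟙 (h y) * B))
                            (cong₂ _+_ (∑-𝟙* g A (allSubsets n)) (∑-𝟙* h B (allSubsets n)))

  module _ {x} (x∈P : x ∈ P) where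
    private
      k = size x
      u = U x

    restrict-inside-step : ∀ y → step true c x y ≡ true →
                           step false c x y ≡ false × 𝟙 (does (hammingDist y c ≤? ρ)) * upFlow k u ≡ upFlow k u
    restrict-inside-step y x→y = step-exclusive c x y x→y ,
      trans (cong (λ b → 𝟙 b * upFlow k u) (dec-true (hammingDist y c ≤? ρ) (Equivalence.to (∈P⇔inBall y) (inside-step-∈P x→y x∈P))))
            (*-identityˡ (upFlow k u))

    restrict-outside-step : ∀ y → step false c x y ≡ true →
                            𝟙 (does (hammingDist y c ≤? ρ)) * sideFlow k u ≡ 𝟙 (does (admissible? (suc k) u)) * sideFlow k u
    restrict-outside-step y x→y = cong (λ b → 𝟙 b * sideFlow k u)
      (trans (inBall≡admissible y) (cong₂ (λ k′ u′ → does (admissible? k′ u′)) (step⇒size false x→y) (proj₂ (step⇒count false c x y x→y))))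

    outflow : ∑[ y ← P ] flow x y ≤ layerWeight P x
    outflow = begin
      ∑[ y ← P ] flow x y
        ≡⟨ ∑P≡∑𝟙* (flow x) ⟩
      ∑[ y ← allSubsets n ] (𝟙 (does (hammingDist y c ≤? ρ)) * flow x y)
        ≡⟨ ∑-cong (allSubsets n) (λ {y} _ → 𝟙*-steps (does (hammingDist y c ≤? ρ)) (step true c x y) (step false c x y)
                                                     (upFlow k u) (sideFlow k u) (upFlow k u) (𝟙 (does (admissible? (suc k) u)) * sideFlow k u)
                                                     (restrict-inside-step y) (restrict-outside-step y)) ⟩
      ∑[ y ← allSubsets n ] (𝟙 (step true c x y) * upFlow k u + 𝟙 (step false c x y) * (𝟙 (does (admissible? (suc k) u)) * sideFlow k u))
        ≡⟨ ∑-steps (step true c x) (step false c x) (upFlow k u) (𝟙 (does (admissible? (suc k) u)) * sideFlow k u) ⟩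
      fromℕ (∑ℕ.∑ (allSubsets n) (𝟙ℕ ∘ step true c x)) * upFlow k u
        + fromℕ (∑ℕ.∑ (allSubsets n) (𝟙ℕ ∘ step false c x)) * (𝟙 (does (admissible? (suc k) u)) * sideFlow k u)
        ≡⟨ cong₂ (λ a b → fromℕ a * upFlow k u + fromℕ b * (𝟙 (does (admissible? (suc k) u)) * sideFlow k u))
                 (trans (#upperSteps true c x) (missing≡ true x))
                 (trans (#upperSteps false c x) (trans (missing≡ false x) (cong (q ∸_) (B≡size∸U x)))) ⟩
      fromℕ (p ∸ u) * upFlow k u + fromℕ (q ∸ (k ∸ u)) * (𝟙 (does (admissible? (suc k) u)) * sideFlow k u)
        ≤⟨ outflow≤inv[N] (∈P⇒admissible x∈P) (count≤sideSize true x) (subst (ℕ._≤ q) (B≡size∸U x) (count≤sideSize false x)) ⟩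
      inv (N k)
        ≡⟨ cong inv (layerSize≡N x∈P) ⟨
      layerWeight P x ∎
      where open ≤-Reasoning

  module _ {y} (y∈P : y ∈ P) where

    received-bottom : height y ≡ 0 → ∑[ x ← P ] flow x y ≡ 0ℚ
    received-bottom h≡0 = trans (∑-cong P (λ {x} x∈P → flow-⊂ (λ x⊂y → ℕ.n≮0 (subst (height x ℕ.<_) h≡0 (height-mono y∈P x∈P x⊂y)))))
                                (∑-0 P)

    module _ (0<h : 0 ℕ.< height y) where
      private
        k = pred (size y)
        u = U y
        up-term = 𝟙 (does (admissible? k (pred u))) * upFlow k (pred u)

        p∸ρ<size : p ∸ ρ ℕ.< size y
        p∸ρ<size = ℕ.m∸n≢0⇒n<m (ℕ.<⇒≢ 0<h ∘ sym)

        size≡ : size y ≡ suc k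
        size≡ = sym (ℕ.suc-pred (size y) {{ℕ.>-nonZero (ℕ.≤-trans (s≤s z≤n) p∸ρ<size)}})

        B≡ : B y ≡ suc k ∸ u
        B≡ = trans (B≡size∸U y) (cong (_∸ u) size≡)

      restrict-inside-source : ∀ x → step true c x y ≡ true →
                               step false c x y ≡ false × 𝟙 (does (hammingDist x c ≤? ρ)) * upFlow (size x) (U x) ≡ up-term
      restrict-inside-source x x→y = step-exclusive c x y x→y ,
        trans (cong (λ b → 𝟙 b * upFlow (size x) (U x)) (inBall≡admissible x))
              (cong₂ (λ k′ u′ → 𝟙 (does (admissible? k′ u′)) * upFlow k′ u′)
                     (cong pred (sym (step⇒size true x→y))) (cong pred (sym (proj₁ (step⇒count true c x y x→y)))))

      restrict-outside-source : ∀ x → step false c x y ≡ true → 𝟙 (does (hammingDist x c ≤? ρ)) * sideFlow (size x) (U x) ≡ sideFlow k u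
      restrict-outside-source x x→y = begin
        𝟙 (does (hammingDist x c ≤? ρ)) * sideFlow (size x) (U x)
          ≡⟨ cong (λ b → 𝟙 b * sideFlow (size x) (U x))
                  (dec-true (hammingDist x c ≤? ρ) (Equivalence.to (∈P⇔inBall x) (outside-step-∈P x→y y∈P))) ⟩
        1ℚ * sideFlow (size x) (U x)
          ≡⟨ *-identityˡ (sideFlow (size x) (U x)) ⟩
        sideFlow (size x) (U x)
          ≡⟨ cong₂ sideFlow (cong pred (sym (step⇒size false x→y))) (sym (proj₂ (step⇒count false c x y x→y))) ⟩
        sideFlow k u ∎
        where open ≡-Reasoning

      received-top : ∑[ x ← P ] flow x y ≡ inv (N (size y))
      received-top = begin
        ∑[ x ← P ] flow x y
          ≡⟨ ∑P≡∑𝟙* (λ x → flow x y) ⟩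
        ∑[ x ← allSubsets n ] (𝟙 (does (hammingDist x c ≤? ρ)) * flow x y)
          ≡⟨ ∑-cong (allSubsets n) (λ {x} _ → 𝟙*-steps (does (hammingDist x c ≤? ρ)) (step true c x y) (step false c x y)
                                                       (upFlow (size x) (U x)) (sideFlow (size x) (U x)) up-term (sideFlow k u)
                                                       (restrict-inside-source x) (restrict-outside-source x)) ⟩
        ∑[ x ← allSubsets n ] (𝟙 (step true c x y) * up-term + 𝟙 (step false c x y) * sideFlow k u)
          ≡⟨ ∑-steps (λ x → step true c x y) (λ x → step false c x y) up-term (sideFlow k u) ⟩
        fromℕ (∑ℕ.∑ (allSubsets n) (λ x → 𝟙ℕ (step true c x y))) * up-term
          + fromℕ (∑ℕ.∑ (allSubsets n) (λ x → 𝟙ℕ (step false c x y))) * sideFlow k u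
          ≡⟨ cong₂ (λ a b → fromℕ a * up-term + fromℕ b * sideFlow k u) (#lowerSteps true c y) (trans (#lowerSteps false c y) B≡) ⟩
        fromℕ u * up-term + fromℕ (suc k ∸ u) * sideFlow k u
          ≡⟨ inflow≡inv[N] (subst (λ k′ → Admissible k′ u) size≡ (∈P⇒admissible y∈P)) (count≤sideSize true y)
                           (subst (ℕ._≤ q) B≡ (count≤sideSize false y)) (ℕ.≤-pred (subst (p ∸ ρ ℕ.<_) size≡ p∸ρ<size)) ⟩
        inv (N (suc k))
          ≡⟨ cong (inv ∘ N) size≡ ⟨
        inv (N (size y)) ∎
        where open ≡-Reasoning

  inflow : ∀ {y} → y ∈ P → ∑[ x ← P ] flow x y + sourceWeight P y ≡ layerWeight P y
  inflow {y} y∈P = split (rank P y ℕ.≟ 0)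
    where
    μ = layerWeight P y
    split : (r≟0 : Dec (rank P y ≡ 0)) → ∑[ x ← P ] flow x y + 𝟙 (does r≟0) * μ ≡ μ
    split (yes r≡0) = trans (cong₂ _+_ (received-bottom y∈P (trans (sym (rank≡h y∈P)) r≡0)) (*-identityˡ μ)) (+-identityˡ μ)
    split (no  r≢0) = trans (cong₂ _+_ (trans (received-top y∈P (ℕ.n≢0⇒n>0 (r≢0 ∘ trans (rank≡h y∈P)))) (cong inv (sym (layerSize≡N y∈P))))
                                       (*-zeroˡ μ))
                            (+-identityʳ μ)

  ballFlow : Flow P (layerWeight P) (sourceWeight P)
  ballFlow = record
    { flow        = flow
    ; flow-nonNeg = flow-nonNeg
    ; flow-⊂      = λ _ _ → flow-⊂
    ; outflow≤    = outflow
    ; inflow      = inflow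
    }

theorem4 : (p q ρ : ℕ) → IsLYM (hammingBall p q ρ)
theorem4 p q ρ = Flow⇒IsLYM (hammingBall p q ρ) (HammingBallFlow.ballFlow (centre p q) ρ)
  where open FlowBound using (Flow⇒IsLYM)
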